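{- Let $s,\ell$ be integers with $1\le s\le\ell$ and $\ell>1$. For integers $n\ge\ell$ and $k\ge1$, let $C^{(\ell,s)}_{n,k}$ denote the number of cycles of length $s$ of $\big((1\,2\,\cdots\,\ell)\big)^{\odot k}$, where $(1\,2\,\cdots\,\ell)\in\mathfrak{S}_n$ is the $\ell$-cycle fixing $\ell+1,\dots,n$. Then $$C^{(\ell,s)}_{n,k}=\begin{cases}1 & \text{if } k=1 \text{ and } s=\ell,\\ n-\ell & \text{if } k=1\text{ and } s=1,\\ 0 & \text{if } k=1 \text{ and } s\notin\{1,\ell\},\\ \displaystyle\left[s\mid\ell \text{ and } \tfrac{\ell}{s}\mid k\right]\frac{\ell}{s\ell+sk}\sum_{e\mid \gcd(s,\,sk/\ell)}\mu(e)\binom{(s+sk/\ell)/e}{s/e} & \text{if } k>1 \text{ and } n=\ell,\\ C^{(\ell,s)}_{n-1,k}+C^{(\ell,s)}_{n,k-1} & \text{otherwise (i.e. } k>1,\ n>\ell).\end{cases}$$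
   Context: For positive integers $n,k$, let $\mathcal{C}_{n,k}$ be the set of weakly increasing $k$-tuples $(i_1\le\cdots\le i_k)$ with entries in $[n]$ (equivalently, $k$-element multisets from $[n]$). For $\sigma\in\mathfrak{S}_n$, the $k$-th symmetric tensor power $\sigma^{\odot k}$ is the permutation of $\mathcal{C}_{n,k}$ sending $(i_1,\dots,i_k)$ to the weakly increasing rearrangement of $(\sigma(i_1),\dots,\sigma(i_k))$ (equivalently, the permutation given by the $k$-th symmetric tensor power of the permutation matrix of $\sigma$). $[P]$ is the Iverson bracket ($1$ if $P$ is true, $0$ otherwise; when it is $0$ the whole expression is $0$), and $\mu$ is the number-theoretic Möbius function. -}

module Defs where

open import Data.Nat using (ℕ; zero; suc; _+_; _*_; _∸_; _≤_; _<_; _≤ᵇ_; _<ᵇ_; _≡ᵇ_)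
open import Data.Nat.DivMod using (_/_)
open import Data.Nat.Divisibility using (_∣_; _∣?_)
open import Data.Nat.GCD using (gcd)
open import Data.Nat.Primality using (Prime; prime?)
open import Data.Nat.Combinatorics using (_C_)
open import Data.Integer as ℤ using (ℤ; +_; -_)
open import Data.Bool using (Bool; true; false; if_then_else_; _∧_; not)
open import Data.List using (List; []; _∷_; map; length; filter; concatMap; foldr; sum)
open import Data.List.Properties using (≡-dec)
open import Data.Nat.Properties using (_≟_)
open import Relation.Nullary.Decidable using (⌊_⌋; Dec; yes; no; ¬?)
open import Function using (_∘_)
open import Data.Bool.Properties using () renaming (_≟_ to _≟B_)

-- natural-number division, with the convention m div 0 = 0
_div_ : ℕ → ℕ → ℕ
m div zero    = 0
m div (suc n) = m / suc n

-- [a, b] = a, a+1, ..., b  (empty if b < a); defined as the list of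
-- length (suc b ∸ a) starting at a
range : ℕ → ℕ → List ℕ
range a b = go a (suc b ∸ a)
  where
  go : ℕ → ℕ → List ℕ
  go x zero    = []
  go x (suc m) = x ∷ go (suc x) m

iter : {A : Set} → (A → A) → ℕ → A → A
iter f zero    x = x
iter f (suc m) x = f (iter f m x)

-- C_{n,k}: weakly increasing k-tuples with entries in [n] = {1..n},
-- represented as lists of naturals of length k.

incFrom : ℕ → ℕ → ℕ → List (List ℕ)
incFrom lo n zero    = [] ∷ []
incFrom lo n (suc k) = concatMap (λ i → map (i ∷_) (incFrom i n k)) (range lo n)

Cnk : ℕ → ℕ → List (List ℕ)
Cnk n k = incFrom 1 n k

insert : ℕ → List ℕ → List ℕ
insert x []       = x ∷ []
insert x (y ∷ ys) = if x ≤ᵇ y then x ∷ y ∷ ys else y ∷ insert x ys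

sortℕ : List ℕ → List ℕ
sortℕ = foldr insert []

-- the k-th symmetric tensor power of σ (acting on [n]) as a map on C_{n,k}:
-- (i₁,…,i_k) ↦ weakly increasing rearrangement of (σ i₁,…,σ i_k)
symPow : (ℕ → ℕ) → List ℕ → List ℕ
symPow σ t = sortℕ (map σ t)

lcycle : ℕ → ℕ → ℕ
lcycle ℓ i = if (1 ≤ᵇ i) ∧ (i <ᵇ ℓ) then suc i
             else if i ≡ᵇ ℓ then 1 else i

_==L_ : List ℕ → List ℕ → Bool
a ==L b = ⌊ ≡-dec _≟_ a b ⌋

onCycleOfLength : (List ℕ → List ℕ) → ℕ → List ℕ → Bool
onCycleOfLength f s x =
  (1 ≤ᵇ s) ∧ (iter f s x ==L x) ∧
  foldr (λ m b → not (iter f m x ==L x) ∧ b) true (range 1 (s ∸ 1))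

-- number of cycles of length s = (number of points on s-cycles) / s
numCycles : List (List ℕ) → (List ℕ → List ℕ) → ℕ → ℕ
numCycles D f s = length (filter (λ x → onCycleOfLength f s x ≟B true) D) div s

Cls : ℕ → ℕ → ℕ → ℕ → ℕ
Cls ℓ s n k = numCycles (Cnk n k) (symPow (lcycle ℓ)) s

squarefree : ℕ → Bool
squarefree n = foldr (λ d b → not ⌊ (d * d) ∣? n ⌋ ∧ b) true (range 2 n)

numPrimeDivisors : ℕ → ℕ
numPrimeDivisors n =
  length (filter (λ p → (⌊ prime? p ⌋ ∧ ⌊ p ∣? n ⌋) ≟B true) (range 2 n))

negPow : ℕ → ℤ
negPow zero    = + 1
negPow (suc m) = - negPow m

μ : ℕ → ℤ
μ n = if squarefree n then negPow (numPrimeDivisors n) else + 0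

sumDivisors : ℕ → (ℕ → ℤ) → ℤ
sumDivisors g f = foldr (λ e acc → (if ⌊ e ∣? g ⌋ then f e else + 0) ℤ.+ acc) (+ 0) (range 1 g)

mobiusSum : ℕ → ℕ → ℕ → ℤ
mobiusSum ℓ s k =
  sumDivisors (gcd s ((s * k) div ℓ))
    (λ e → μ e ℤ.* + (((s + (s * k) div ℓ) div e) C (s div e)))

-- A point of C_{n,k} is determined by its multiplicity vector, a weak composition of k into n
-- parts, and ((1 2 ⋯ ℓ))^{⊙k} acts on these vectors by rotating the first ℓ entries. For ℓ < n
-- the last entry is inert, so splitting the compositions by whether their last part is zero gives
-- the recursion in (n, k); as the points on s-cycles fall into orbits of size s, the number of
-- s-cycles inherits it. For n = ℓ the action is the full cyclic shift. A composition fixed by the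
-- t-th power of the shift, t ∣ ℓ, is d = ℓ/t copies of a composition of k/d into t parts, so there
-- are C(t-1+k/d, t-1) of them if d ∣ k and none otherwise. These fixed-point counts are the sums,
-- over u ∣ t, of the numbers of points on u-cycles; Möbius inversion recovers the points on
-- s-cycles, and the absorption identity (b+1)·C(a+1,b+1) = (a+1)·C(a,b) brings the result into the
-- stated form.

module Submission where

open import Defs
import Algebra.Properties.CommutativeSemigroup as CommutativeSemigroupProperties
open import Data.Bool using (Bool; true; false; T; _∧_; not; if_then_else_)
open import Data.Bool.Properties using (T-≡; ¬-not) renaming (_≟_ to _≟ᵇ_)
open import Data.Empty using (⊥; ⊥-elim)
open import Data.Integer using (ℤ; +_; -_; -[1+_]) renaming (_+_ to _+ℤ_; _*_ to _*ℤ_)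
import Data.Integer.Properties as ℤ
open import Data.List using (List; []; _∷_; _++_; _∷ʳ_; map; length; filter; foldr; take; drop; replicate; concat; applyUpTo; initLast; _∷ʳ′_)
open import Data.List.Properties
  using ( map-id; map-++; map-∘; map-cong; map-cong-local; length-++; length-map; length-replicate; length-take; length-drop
        ; length-applyUpTo; filter-++; filter-all; filter-none; take++drop≡id; take-all; drop-all; ++-identityʳ; ++-assoc
        ; ∷-injective; ∷ʳ-injective; ∷ʳ-injectiveˡ; ∷ʳ-injectiveʳ; ≡-dec )
open import Data.List.Membership.Propositional using (_∈_; _∉_; lose; find)
open import Data.List.Membership.Propositional.Properties
  using (∈-filter⁺; ∈-filter⁻; ∈-map⁺; ∈-map⁻; ∈-++⁺ˡ; ∈-++⁺ʳ; ∈-++⁻; ∈-applyUpTo⁺; ∈-applyUpTo⁻)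
open import Data.List.Membership.Propositional.Properties.WithK using (unique∧set⇒bag)
import Data.List.Membership.DecPropositional as DecMembership
open import Data.List.Relation.Binary.BagAndSetEquality using (∼bag⇒↭)
open import Data.List.Relation.Binary.Permutation.Propositional using (_↭_)
import Data.List.Relation.Binary.Permutation.Propositional as ↭
open import Data.List.Relation.Binary.Permutation.Propositional.Properties using (↭-length; filter-↭)
open import Data.List.Relation.Unary.All as All using (All; []; _∷_)
open import Data.List.Relation.Unary.All.Properties using (++⁺; map⁺)
open import Data.List.Relation.Unary.AllPairs using ([]; _∷_)
open import Data.List.Relation.Unary.Any using (here; there; any?)
open import Data.List.Relation.Unary.Unique.Propositional using (Unique)
import Data.List.Relation.Unary.Unique.Propositional.Properties as Unique
open import Data.Nat
open import Data.Nat.Combinatorics using (_C_; nCk+nC[k+1]≡[n+1]C[k+1]; nCn≡1; nC1≡n)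
open import Data.Nat.Coprimality using (Coprime; coprime-divisor)
open import Data.Nat.Divisibility
open import Data.Nat.DivMod using (_/_; _%_; m≡m%n+[m/n]*n; m%n<n; m*[n/m]≡n; m*n/n≡m; m/n≤m; n/n≡1; n/1≡n; +-distrib-/-∣ˡ)
open import Data.Nat.GCD using (gcd; gcd[m,n]∣m; gcd[m,n]∣n; gcd-greatest; gcd[m,n]≢0)
open import Data.Nat.Induction using (<-wellFounded)
open import Data.Nat.ListAction using (sum; product)
open import Data.Nat.ListAction.Properties using (sum-++)
open import Data.Nat.Primality using (Prime; prime?; euclidsLemma; prime⇒irreducible; prime⇒nonTrivial)
open import Data.Nat.Primality.Factorisation using (factorise)
open import Data.Nat.Properties
open import Data.Nat.Tactic.RingSolver using (solve-∀)
open import Data.Product using (Σ; _×_; _,_; proj₁; proj₂)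
open import Data.Sum using (_⊎_; inj₁; inj₂; reduce)
open import Function.Base using (_∘_; _∘′_; id)
open import Function.Bundles using (_⇔_; mk⇔; Equivalence)
open import Induction.WellFounded using (Acc; acc)
open import Level using (0ℓ)
open import Relation.Binary.Definitions using (DecidableEquality; tri<; tri≈; tri>)
open import Relation.Binary.PropositionalEquality
open import Relation.Nullary
open import Relation.Nullary.Decidable using (⌊_⌋; _×-dec_)
open import Relation.Unary using (Pred; Decidable)

open CommutativeSemigroupProperties +-commutativeSemigroup using (interchange)
open CommutativeSemigroupProperties ℤ.+-commutativeSemigroup using () renaming (interchange to +ℤ-interchange)
open CommutativeSemigroupProperties ℤ.*-commutativeSemigroup using () renaming (x∙yz≈y∙xz to *ℤ-left-comm)

upFrom : ℕ → ℕ → List ℕ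
upFrom a zero    = []
upFrom a (suc m) = a ∷ upFrom (suc a) m

upFrom-bounded : ∀ a m → All (λ i → a ≤ i × i < a + m) (upFrom a m)
upFrom-bounded a zero    = []
upFrom-bounded a (suc m) = (≤-refl , a<a+suc) ∷
  All.map (λ {i} (a<i , i<) → <⇒≤ a<i , subst (i <_) (sym (+-suc a m)) i<) (upFrom-bounded (suc a) m)
  where
  a<a+suc : a < a + suc m
  a<a+suc = subst (a <_) (sym (+-suc a m)) (s≤s (m≤m+n a m))

∈-upFrom⁻ : ∀ {a m i} → i ∈ upFrom a m → a ≤ i × i < a + m
∈-upFrom⁻ {a} {m} = All.lookup (upFrom-bounded a m)

∈-upFrom⁺ : ∀ {a m i} → a ≤ i → i < a + m → i ∈ upFrom a m
∈-upFrom⁺ {a} {zero}  {i} a≤i i<a+0 = ⊥-elim (<-irrefl refl (≤-trans i<a+0 (subst (_≤ i) (sym (+-identityʳ a)) a≤i)))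
∈-upFrom⁺ {a} {suc m} {i} a≤i i<a+m with a ≟ i
... | yes refl = here refl
... | no a≢i   = there (∈-upFrom⁺ (≤∧≢⇒< a≤i a≢i) (subst (i <_) (+-suc a m) i<a+m))

upFrom-unique : ∀ a m → Unique (upFrom a m)
upFrom-unique a zero    = []
upFrom-unique a (suc m) = All.map (λ (a<i , _) a≡i → <-irrefl a≡i a<i) (upFrom-bounded (suc a) m) ∷ upFrom-unique (suc a) m

upFrom-++ : ∀ a m m′ → upFrom a (m + m′) ≡ upFrom a m ++ upFrom (a + m) m′
upFrom-++ a zero    m′ = cong (λ b → upFrom b m′) (sym (+-identityʳ a))
upFrom-++ a (suc m) m′ = cong (a ∷_) (trans (upFrom-++ (suc a) m m′) (cong (λ b → upFrom (suc a) m ++ upFrom b m′) (sym (+-suc a m))))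

length-upFrom : ∀ a m → length (upFrom a m) ≡ m
length-upFrom a zero    = refl
length-upFrom a (suc m) = cong suc (length-upFrom (suc a) m)

map-pred-upFrom : ∀ a m → map pred (upFrom (suc a) m) ≡ upFrom a m
map-pred-upFrom a zero    = refl
map-pred-upFrom a (suc m) = cong (a ∷_) (map-pred-upFrom (suc a) m)

range-≤ : ∀ {a b} → a ≤ b → range a b ≡ a ∷ range (suc a) b
range-≤ a≤b rewrite +-∸-assoc 1 a≤b = refl

range-> : ∀ {a b} → b < a → range a b ≡ []
range-> b<a rewrite m≤n⇒m∸n≡0 b<a = refl

range≡upFrom : ∀ a b → range a b ≡ upFrom a (suc b ∸ a)
range≡upFrom a b = go (suc b ∸ a) a refl
  where
  go : ∀ m a → suc b ∸ a ≡ m → range a b ≡ upFrom a m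
  go zero    a b<a = range-> (m∸n≡0⇒m≤n b<a)
  go (suc m) a eq with a ≤? b
  ... | yes a≤b = trans (range-≤ a≤b) (cong (a ∷_) (go m (suc a) (suc-injective (trans (sym (+-∸-assoc 1 a≤b)) eq))))
  ... | no a≰b rewrite m≤n⇒m∸n≡0 (≰⇒> a≰b) with () ← eq

module _ {A : Set} where

  take-length-++ : ∀ (xs ys : List A) → take (length xs) (xs ++ ys) ≡ xs
  take-length-++ []       ys = refl
  take-length-++ (x ∷ xs) ys = cong (x ∷_) (take-length-++ xs ys)

  drop-length-++ : ∀ (xs ys : List A) → drop (length xs) (xs ++ ys) ≡ ys
  drop-length-++ []       ys = refl
  drop-length-++ (x ∷ xs) ys = drop-length-++ xs ys

  take-++-≤ : ∀ n (xs ys : List A) → n ≤ length xs → take n (xs ++ ys) ≡ take n xs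
  take-++-≤ zero    xs       ys _         = refl
  take-++-≤ (suc n) (x ∷ xs) ys (s≤s n≤) = cong (x ∷_) (take-++-≤ n xs ys n≤)

  drop-++-≤ : ∀ n (xs ys : List A) → n ≤ length xs → drop n (xs ++ ys) ≡ drop n xs ++ ys
  drop-++-≤ zero    xs       ys _         = refl
  drop-++-≤ (suc n) (x ∷ xs) ys (s≤s n≤) = drop-++-≤ n xs ys n≤

take-replicate : ∀ ℓ n (a : ℕ) → take ℓ (replicate n a) ≡ replicate (ℓ ⊓ n) a
take-replicate zero    n       a = refl
take-replicate (suc ℓ) zero    a = refl
take-replicate (suc ℓ) (suc n) a = cong (a ∷_) (take-replicate ℓ n a)

map-≡-∈ : ∀ {A B : Set} {f g : A → B} {xs x} → map f xs ≡ map g xs → x ∈ xs → f x ≡ g x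
map-≡-∈ {xs = _ ∷ _} eq (here refl)  = proj₁ (∷-injective eq)
map-≡-∈ {xs = _ ∷ _} eq (there x∈xs) = map-≡-∈ (proj₂ (∷-injective eq)) x∈xs

module _ {A : Set} where

  unique-↭ : ∀ {xs ys : List A} → Unique xs → Unique ys → (∀ {z} → z ∈ xs → z ∈ ys) → (∀ {z} → z ∈ ys → z ∈ xs) → xs ↭ ys
  unique-↭ xs! ys! xs⊆ys ys⊆xs = ∼bag⇒↭ (unique∧set⇒bag xs! ys! (mk⇔ xs⊆ys ys⊆xs))

  module _ {P : Pred A 0ℓ} (P? : Decidable P) where

    length-filter-↭ : ∀ {xs ys} → xs ↭ ys → length (filter P? xs) ≡ length (filter P? ys)
    length-filter-↭ xs↭ys = ↭-length (filter-↭ P? xs↭ys)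

    length-filter-++ : ∀ xs ys → length (filter P? (xs ++ ys)) ≡ length (filter P? xs) + length (filter P? ys)
    length-filter-++ xs ys = trans (cong length (filter-++ P? xs ys)) (length-++ (filter P? xs))

    length-filter-none : ∀ xs → (∀ {x} → x ∈ xs → ¬ P x) → length (filter P? xs) ≡ 0
    length-filter-none xs none = cong length (filter-none P? (All.tabulate none))

    length-filter-all : ∀ xs → (∀ {x} → x ∈ xs → P x) → length (filter P? xs) ≡ length xs
    length-filter-all xs all = cong length (filter-all P? (All.tabulate all))

    length-filter+length-filter-¬ : ∀ xs → length (filter P? xs) + length (filter (¬? ∘ P?) xs) ≡ length xs
    length-filter+length-filter-¬ [] = refl
    length-filter+length-filter-¬ (x ∷ xs) with P? x
    ... | yes _ = cong suc (length-filter+length-filter-¬ xs)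
    ... | no _  = trans (+-suc _ _) (cong suc (length-filter+length-filter-¬ xs))

module _ {A B : Set} {P : Pred A 0ℓ} {Q : Pred B 0ℓ} (P? : Decidable P) (Q? : Decidable Q) where

  length-filter-map : ∀ (g : A → B) xs → (∀ {x} → x ∈ xs → P x ⇔ Q (g x)) →
    length (filter P? xs) ≡ length (filter Q? (map g xs))
  length-filter-map g [] _ = refl
  length-filter-map g (x ∷ xs) P⇔Q with P? x | Q? (g x)
  ... | yes _  | yes _  = cong suc (length-filter-map g xs (P⇔Q ∘ there))
  ... | no _   | no _   = length-filter-map g xs (P⇔Q ∘ there)
  ... | yes px | no ¬qx = ⊥-elim (¬qx (Equivalence.to (P⇔Q (here refl)) px))
  ... | no ¬px | yes qx = ⊥-elim (¬px (Equivalence.from (P⇔Q (here refl)) qx))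

length-filter-cong : ∀ {A : Set} {P Q : Pred A 0ℓ} (P? : Decidable P) (Q? : Decidable Q) xs →
  (∀ {x} → x ∈ xs → P x ⇔ Q x) → length (filter P? xs) ≡ length (filter Q? xs)
length-filter-cong P? Q? xs P⇔Q = trans (length-filter-map P? Q? id xs P⇔Q) (cong (length ∘ filter Q?) (map-id xs))

indicator : ∀ {P : Set} → Dec P → ℕ
indicator (yes _) = 1
indicator (no _)  = 0

length-filter-∷ : ∀ {A : Set} {P : A → Set} (P? : ∀ x → Dec (P x)) x xs → length (filter P? (x ∷ xs)) ≡ indicator (P? x) + length (filter P? xs)
length-filter-∷ P? x xs with P? x
... | yes _ = refl
... | no _  = refl

length-filter≡sum-indicator : ∀ {A : Set} {P : Pred A 0ℓ} (P? : Decidable P) xs →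
  length (filter P? xs) ≡ sum (map (indicator ∘ P?) xs)
length-filter≡sum-indicator P? [] = refl
length-filter≡sum-indicator P? (x ∷ xs) with P? x
... | yes _ = cong suc (length-filter≡sum-indicator P? xs)
... | no _  = length-filter≡sum-indicator P? xs

module _ {A : Set} where

  sum-map-+ : ∀ (f g : A → ℕ) xs → sum (map (λ x → f x + g x) xs) ≡ sum (map f xs) + sum (map g xs)
  sum-map-+ f g [] = refl
  sum-map-+ f g (x ∷ xs) rewrite sum-map-+ f g xs = interchange (f x) (g x) (sum (map f xs)) (sum (map g xs))

  sum-map-zero : ∀ (f : A → ℕ) xs → (∀ {x} → x ∈ xs → f x ≡ 0) → sum (map f xs) ≡ 0
  sum-map-zero f [] _ = refl
  sum-map-zero f (x ∷ xs) f≡0 rewrite f≡0 (here refl) = sum-map-zero f xs (f≡0 ∘ there)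

  sum-map-single : ∀ (f : A → ℕ) {p xs} → Unique xs → p ∈ xs → (∀ {u} → u ∈ xs → u ≢ p → f u ≡ 0) → sum (map f xs) ≡ f p
  sum-map-single f (x∉xs ∷ _) (here refl) f≡0 =
    trans (cong (_+_ (f _)) (sum-map-zero f _ λ u∈xs → f≡0 (there u∈xs) (λ { refl → All.lookup x∉xs u∈xs refl }))) (+-identityʳ _)
  sum-map-single f {p} {x ∷ xs} (x∉xs ∷ xs!) (there p∈xs) f≡0 =
    trans (cong (_+ sum (map f xs)) (f≡0 (here refl) λ { refl → All.lookup x∉xs p∈xs refl })) (sum-map-single f xs! p∈xs (f≡0 ∘ there))

foldr-not-∧≡true⇔ : ∀ {P : ℕ → Set} (P? : ∀ d → Dec (P d)) xs →
  foldr (λ d b → not ⌊ P? d ⌋ ∧ b) true xs ≡ true ⇔ (∀ {d} → d ∈ xs → ¬ P d)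
foldr-not-∧≡true⇔ P? [] = mk⇔ (λ _ ()) (λ _ → refl)
foldr-not-∧≡true⇔ P? (d ∷ ds) with P? d
... | yes pd = mk⇔ (λ ()) (λ none → ⊥-elim (none (here refl) pd))
... | no ¬pd = mk⇔ (λ rest → λ { (here refl) → ¬pd ; (there d∈) → Equivalence.to (foldr-not-∧≡true⇔ P? ds) rest d∈ })
                   (λ none → Equivalence.from (foldr-not-∧≡true⇔ P? ds) (λ d∈ → none (there d∈)))

∧≡true⇔ : ∀ {a b} → (a ∧ b) ≡ true ⇔ (a ≡ true × b ≡ true)
∧≡true⇔ {true}  {true}  = mk⇔ (λ _ → refl , refl) (λ _ → refl)
∧≡true⇔ {true}  {false} = mk⇔ (λ ()) (λ ())
∧≡true⇔ {false}         = mk⇔ (λ ()) (λ ())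

⌊⌋≡true⇔ : ∀ {P : Set} (P? : Dec P) → ⌊ P? ⌋ ≡ true ⇔ P
⌊⌋≡true⇔ (yes p) = mk⇔ (λ _ → p) (λ _ → refl)
⌊⌋≡true⇔ (no ¬p) = mk⇔ (λ ()) (⊥-elim ∘ ¬p)

≡true⇔≡true⇒≡ : ∀ {a b : Bool} → (a ≡ true ⇔ b ≡ true) → a ≡ b
≡true⇔≡true⇒≡ {true}  {true}  _ = refl
≡true⇔≡true⇒≡ {true}  {false} a⇔b = sym (Equivalence.to a⇔b refl)
≡true⇔≡true⇒≡ {false} {true}  a⇔b = Equivalence.from a⇔b refl
≡true⇔≡true⇒≡ {false} {false} _ = refl

¬T⇒≡false : ∀ {b} → ¬ T b → b ≡ false
¬T⇒≡false ¬t = ¬-not (¬t ∘ Equivalence.from T-≡)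

≤ᵇ≡true⇔ : ∀ {m n} → (m ≤ᵇ n) ≡ true ⇔ m ≤ n
≤ᵇ≡true⇔ {m} {n} = mk⇔ (λ m≤ᵇn → ≤ᵇ⇒≤ m n (Equivalence.from T-≡ m≤ᵇn)) (λ m≤n → Equivalence.to T-≡ (≤⇒≤ᵇ m≤n))

∣⇒≤′ : ∀ {m n} → 1 ≤ n → m ∣ n → m ≤ n
∣⇒≤′ 1≤n = ∣⇒≤ {{>-nonZero 1≤n}}

*-positiveʳ : ∀ a {b} → 1 ≤ a * b → 1 ≤ b
*-positiveʳ a {zero}  1≤a*0 = subst (1 ≤_) (*-zeroʳ a) 1≤a*0
*-positiveʳ a {suc b} _     = s≤s z≤n

div-cancelˡ : ∀ {e s} → 1 ≤ e → e ∣ s → e * (s div e) ≡ s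
div-cancelˡ {suc _} _ e∣s = m*[n/m]≡n e∣s

div-cancelʳ : ∀ q {s} → 1 ≤ s → (q * s) div s ≡ q
div-cancelʳ q {suc s} _ = m*n/n≡m q (suc s)

div-≤ : ∀ s {e} → 1 ≤ e → s div e ≤ s
div-≤ s {suc e} _ = m/n≤m s (suc e)

div-positive : ∀ {e s} → 1 ≤ e → 1 ≤ s → e ∣ s → 1 ≤ s div e
div-positive {e} {s} 1≤e 1≤s e∣s with s div e in eq
... | zero  = ⊥-elim (<-irrefl refl (≤-trans 1≤s (≤-reflexive (trans (sym (div-cancelˡ 1≤e e∣s)) (trans (cong (e *_) eq) (*-zeroʳ e))))))
... | suc _ = s≤s z≤n

div-self : ∀ {s} → 1 ≤ s → s div s ≡ 1
div-self {suc s} _ = n/n≡1 (suc s)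

0-div : ∀ s → 0 div s ≡ 0
0-div zero    = refl
0-div (suc s) = refl

div-+ˡ : ∀ {s a} b → 1 ≤ s → s ∣ a → (a + b) div s ≡ a div s + b div s
div-+ˡ {suc s} b _ s∣a = +-distrib-/-∣ˡ b s∣a

*-∣⇒∣div : ∀ {a b s} → 1 ≤ a → a * b ∣ s → b ∣ s div a
*-∣⇒∣div {suc a} {b} _ ab∣s = m*n∣o⇒n∣o/m (suc a) b ab∣s

-- Iteration, minimal periods and orbits

module _ {A : Set} (f : A → A) where

  iter-step : ∀ m x → iter f m (f x) ≡ f (iter f m x)
  iter-step zero    x = refl
  iter-step (suc m) x = cong f (iter-step m x)

  iter-+ : ∀ a b x → iter f (a + b) x ≡ iter f a (iter f b x)
  iter-+ zero    b x = refl
  iter-+ (suc a) b x = cong f (iter-+ a b x)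

  iter-comm : ∀ a b x → iter f a (iter f b x) ≡ iter f b (iter f a x)
  iter-comm a b x = trans (sym (iter-+ a b x)) (trans (cong (λ c → iter f c x) (+-comm a b)) (iter-+ b a x))

  iter-fixed : ∀ m {x} → f x ≡ x → iter f m x ≡ x
  iter-fixed zero    fx≡x = refl
  iter-fixed (suc m) fx≡x = trans (cong f (iter-fixed m fx≡x)) fx≡x

  iter-*-fixed : ∀ q {p x} → iter f p x ≡ x → iter f (q * p) x ≡ x
  iter-*-fixed zero    fix = refl
  iter-*-fixed (suc q) {p} {x} fix = trans (iter-+ p (q * p) x) (trans (cong (iter f p) (iter-*-fixed q fix)) fix)

  iter-∣-fixed : ∀ {p t x} → iter f p x ≡ x → p ∣ t → iter f t x ≡ x
  iter-∣-fixed fix (divides q refl) = iter-*-fixed q fix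

  iter-pred : ∀ {s} → 1 ≤ s → ∀ x → iter f (s ∸ 1) (f x) ≡ iter f s x
  iter-pred {suc s} _ = iter-step s

module _ {A B : Set} {f : A → A} {g : B → B} (h : A → B) (h∘f≗g∘h : ∀ x → h (f x) ≡ g (h x)) where

  iter-homomorphic : ∀ m x → h (iter f m x) ≡ iter g m (h x)
  iter-homomorphic zero    x = refl
  iter-homomorphic (suc m) x = trans (h∘f≗g∘h (iter f m x)) (cong g (iter-homomorphic m x))

iter-inverse : ∀ {A : Set} {f g : A → A} → (∀ x → g (f x) ≡ x) → ∀ m x → iter g m (iter f m x) ≡ x
iter-inverse         g∘f≗id zero    x = refl
iter-inverse {f = f} {g} g∘f≗id (suc m) x =
  trans (sym (iter-step g m _)) (trans (cong (iter g m) (g∘f≗id (iter f m x))) (iter-inverse g∘f≗id m x))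

record MinimalPeriod {A : Set} (f : A → A) (s : ℕ) (x : A) : Set where
  field
    positive : 1 ≤ s
    periodic : iter f s x ≡ x
    minimal  : ∀ m → 1 ≤ m → m < s → iter f m x ≢ x

module _ {A : Set} {f : A → A} where

  minimalPeriod-cong : ∀ {g : A → A} {s x y} → (∀ m → iter f m x ≡ x → iter g m y ≡ y) → (∀ m → iter g m y ≡ y → iter f m x ≡ x) →
    MinimalPeriod f s x → MinimalPeriod g s y
  minimalPeriod-cong {s = s} to from per = record
    { positive = positive ; periodic = to s periodic ; minimal = λ m 1≤m m<s → minimal m 1≤m m<s ∘ from m }
    where open MinimalPeriod per

  minimalPeriod-step : ∀ {s x} → MinimalPeriod f s x → MinimalPeriod f s (f x)
  minimalPeriod-step {s} {x} per = minimalPeriod-cong to from per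
    where
    open MinimalPeriod per
    to : ∀ m → iter f m x ≡ x → iter f m (f x) ≡ f x
    to m fix = trans (iter-step f m x) (cong f fix)
    from : ∀ m → iter f m (f x) ≡ f x → iter f m x ≡ x
    from m fix = begin
      iter f m x                     ≡⟨ cong (iter f m) (trans (sym periodic) (sym (iter-pred f positive x))) ⟩
      iter f m (iter f (s ∸ 1) (f x)) ≡⟨ iter-comm f m (s ∸ 1) (f x) ⟩
      iter f (s ∸ 1) (iter f m (f x)) ≡⟨ cong (iter f (s ∸ 1)) fix ⟩
      iter f (s ∸ 1) (f x)            ≡⟨ iter-pred f positive x ⟩
      iter f s x                     ≡⟨ periodic ⟩
      x                              ∎
      where open ≡-Reasoning

  minimalPeriod-∣ : ∀ {p t x} → MinimalPeriod f p x → iter f t x ≡ x → p ∣ t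
  minimalPeriod-∣ {suc p} {t} {x} per fix with t % suc p in t%p
  ... | zero  = m%n≡0⇒n∣m t (suc p) t%p
  ... | suc r = ⊥-elim (MinimalPeriod.minimal per (suc r) (s≤s z≤n) (subst (_< suc p) t%p (m%n<n t (suc p))) fix-r)
    where
    open ≡-Reasoning
    fix-r : iter f (suc r) x ≡ x
    fix-r = begin
      iter f (suc r) x                           ≡⟨ cong (iter f (suc r)) (sym (iter-*-fixed f (t / suc p) (MinimalPeriod.periodic per))) ⟩
      iter f (suc r) (iter f (t / suc p * suc p) x) ≡⟨ sym (iter-+ f (suc r) _ x) ⟩
      iter f (suc r + t / suc p * suc p) x       ≡⟨ cong (λ c → iter f (c + t / suc p * suc p) x) (sym t%p) ⟩
      iter f (t % suc p + t / suc p * suc p) x   ≡⟨ cong (λ c → iter f c x) (sym (m≡m%n+[m/n]*n t (suc p))) ⟩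
      iter f t x                                 ≡⟨ fix ⟩
      x                                          ∎

  minimalPeriod-unique : ∀ {p q x} → MinimalPeriod f p x → MinimalPeriod f q x → p ≡ q
  minimalPeriod-unique {p} {q} perp perq with <-cmp p q
  ... | tri< p<q _ _ = ⊥-elim (MinimalPeriod.minimal perq p (MinimalPeriod.positive perp) p<q (MinimalPeriod.periodic perp))
  ... | tri≈ _ p≡q _ = p≡q
  ... | tri> _ _ q<p = ⊥-elim (MinimalPeriod.minimal perp q (MinimalPeriod.positive perq) q<p (MinimalPeriod.periodic perq))

  minimalPeriod-exists : DecidableEquality A → ∀ {t x} → 1 ≤ t → iter f t x ≡ x → Σ ℕ λ p → p ≤ t × MinimalPeriod f p x
  minimalPeriod-exists _≟_ {t} {x} = go t (<-wellFounded t)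
    where
    go : ∀ t → Acc _<_ t → 1 ≤ t → iter f t x ≡ x → Σ ℕ λ p → p ≤ t × MinimalPeriod f p x
    go t (acc smaller) 1≤t fix with any? (λ m → iter f m x ≟ x) (upFrom 1 (t ∸ 1))
    ... | no none = t , ≤-refl , record
          { positive = 1≤t ; periodic = fix
          ; minimal = λ m 1≤m m<t → none ∘ lose (∈-upFrom⁺ 1≤m (subst (m <_) (sym (m+[n∸m]≡n 1≤t)) m<t)) }
    ... | yes some with find some
    ...   | m , m∈ , fixm with ∈-upFrom⁻ m∈
    ...     | 1≤m , m<1+[t∸1] with m<t ← subst (m <_) (m+[n∸m]≡n 1≤t) m<1+[t∸1]
                             with go m (smaller m<t) 1≤m fixm
    ...       | p , p≤m , per = p , ≤-trans p≤m (<⇒≤ m<t) , per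

==L≡true⇔ : ∀ {u v} → (u ==L v) ≡ true ⇔ u ≡ v
==L≡true⇔ {u} {v} = ⌊⌋≡true⇔ (≡-dec _≟_ u v)

module _ (f : List ℕ → List ℕ) (x : List ℕ) where

  onCycleOfLength≡true⇔ : ∀ s → onCycleOfLength f s x ≡ true ⇔ MinimalPeriod f s x
  onCycleOfLength≡true⇔ s = mk⇔ to from
    where
    no-return = foldr-not-∧≡true⇔ (λ m → ≡-dec _≟_ (iter f m x) x) (range 1 (s ∸ 1))
    ∈range⇔ : ∀ {m} → 1 ≤ s → m ∈ range 1 (s ∸ 1) ⇔ (1 ≤ m × m < s)
    ∈range⇔ {m} 1≤s = mk⇔
      (λ m∈ → let 1≤m , m< = ∈-upFrom⁻ (subst (m ∈_) (range≡upFrom 1 (s ∸ 1)) m∈) in 1≤m , subst (m <_) (m+[n∸m]≡n 1≤s) m<)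
      (λ (1≤m , m<s) → subst (m ∈_) (sym (range≡upFrom 1 (s ∸ 1))) (∈-upFrom⁺ 1≤m (subst (m <_) (sym (m+[n∸m]≡n 1≤s)) m<s)))
    to : onCycleOfLength f s x ≡ true → MinimalPeriod f s x
    to on with Equivalence.to (∧≡true⇔ {1 ≤ᵇ s}) on
    ... | 1≤ᵇs , rest with Equivalence.to (∧≡true⇔ {iter f s x ==L x}) rest
    ...   | periodic , minimal with 1≤s ← Equivalence.to ≤ᵇ≡true⇔ 1≤ᵇs = record
      { positive = 1≤s
      ; periodic = Equivalence.to ==L≡true⇔ periodic
      ; minimal  = λ m 1≤m m<s → Equivalence.to no-return minimal (Equivalence.from (∈range⇔ 1≤s) (1≤m , m<s)) }
    from : MinimalPeriod f s x → onCycleOfLength f s x ≡ true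
    from per = Equivalence.from ∧≡true⇔ (Equivalence.from ≤ᵇ≡true⇔ positive , Equivalence.from ∧≡true⇔
      (Equivalence.from ==L≡true⇔ periodic , Equivalence.from no-return λ m∈ → let 1≤m , m<s = Equivalence.to (∈range⇔ positive) m∈ in minimal _ 1≤m m<s))
      where open MinimalPeriod per

module _ {A : Set} (_≟_ : DecidableEquality A) (f : A → A) {s : ℕ} where
  open DecMembership _≟_ using (_∈?_)

  orbit : A → List A
  orbit x = applyUpTo (λ i → iter f i x) s

  module _ {x : A} (per : MinimalPeriod f s x) where
    open MinimalPeriod per

    orbit-unique : Unique (orbit x)
    orbit-unique = Unique.applyUpTo⁺₁ _ s λ {i} {j} i<j j<s fi≡fj →
      let s∸j+j≡s = m∸n+n≡m (<⇒≤ j<s) in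
      minimal (s ∸ j + i) (≤-trans (m<n⇒0<n∸m j<s) (m≤m+n _ i)) (subst (s ∸ j + i <_) s∸j+j≡s (+-monoʳ-< (s ∸ j) i<j)) (begin
        iter f (s ∸ j + i) x         ≡⟨ iter-+ f (s ∸ j) i x ⟩
        iter f (s ∸ j) (iter f i x)  ≡⟨ cong (iter f (s ∸ j)) fi≡fj ⟩
        iter f (s ∸ j) (iter f j x)  ≡⟨ sym (iter-+ f (s ∸ j) j x) ⟩
        iter f (s ∸ j + j) x         ≡⟨ cong (λ c → iter f c x) s∸j+j≡s ⟩
        iter f s x                   ≡⟨ periodic ⟩
        x                            ∎)
      where open ≡-Reasoning

    iter∈orbit : ∀ j → iter f j x ∈ orbit x
    iter∈orbit j = subst (_∈ orbit x) (begin
        iter f (j % s) x                          ≡⟨ cong (iter f (j % s)) (sym (iter-*-fixed f (j / s) periodic)) ⟩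
        iter f (j % s) (iter f (j / s * s) x)     ≡⟨ sym (iter-+ f (j % s) _ x) ⟩
        iter f (j % s + j / s * s) x              ≡⟨ cong (λ c → iter f c x) (sym (m≡m%n+[m/n]*n j s)) ⟩
        iter f j x                                ∎)
      (∈-applyUpTo⁺ (λ i → iter f i x) (m%n<n j s))
      where
      open ≡-Reasoning
      instance _ = >-nonZero positive

    ∉orbit-step : ∀ {y} → MinimalPeriod f s y → y ∉ orbit x → f y ∉ orbit x
    ∉orbit-step {y} per-y y∉ fy∈ with i , _ , fy≡ ← ∈-applyUpTo⁻ (λ i → iter f i x) fy∈ =
      y∉ (subst (_∈ orbit x) y≡ (iter∈orbit (s ∸ 1 + i)))
      where
      open ≡-Reasoning
      y≡ : iter f (s ∸ 1 + i) x ≡ y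
      y≡ = begin
        iter f (s ∸ 1 + i) x          ≡⟨ iter-+ f (s ∸ 1) i x ⟩
        iter f (s ∸ 1) (iter f i x)   ≡⟨ cong (iter f (s ∸ 1)) (sym fy≡) ⟩
        iter f (s ∸ 1) (f y)          ≡⟨ iter-pred f (MinimalPeriod.positive per-y) y ⟩
        iter f s y                    ≡⟨ MinimalPeriod.periodic per-y ⟩
        y                             ∎

  orbit-⊆ : ∀ {x L} → x ∈ L → (∀ {y} → y ∈ L → f y ∈ L) → ∀ {z} → z ∈ orbit x → z ∈ L
  orbit-⊆ {x} {L} x∈ closed z∈ with i , _ , refl ← ∈-applyUpTo⁻ (λ i → iter f i x) z∈ = iter∈ i
    where
    iter∈ : ∀ i → iter f i x ∈ L
    iter∈ zero    = x∈
    iter∈ (suc i) = closed (iter∈ i)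

  minimalPeriod-∣-length : ∀ L → Unique L → (∀ {y} → y ∈ L → f y ∈ L) → (∀ {y} → y ∈ L → MinimalPeriod f s y) → s ∣ length L
  minimalPeriod-∣-length L = go L (<-wellFounded (length L))
    where
    go : ∀ L → Acc _<_ (length L) → Unique L → (∀ {y} → y ∈ L → f y ∈ L) → (∀ {y} → y ∈ L → MinimalPeriod f s y) → s ∣ length L
    go []      _             _  _      _   = s ∣0
    go (x ∷ L) (acc shorter) L! closed per =
      subst (s ∣_) split (∣m∣n⇒∣m+n ∣-refl (go rest (shorter rest<) (Unique.filter⁺ outside? L!) rest-closed (per ∘ rest⊆)))
      where
      outside? = ¬? ∘ (_∈? orbit x)
      rest = filter outside? (x ∷ L)

      rest⊆ : ∀ {y} → y ∈ rest → y ∈ x ∷ L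
      rest⊆ y∈ = proj₁ (∈-filter⁻ outside? y∈)

      rest-closed : ∀ {y} → y ∈ rest → f y ∈ rest
      rest-closed y∈ = ∈-filter⁺ outside? (closed (rest⊆ y∈)) (∉orbit-step (per (here refl)) (per (rest⊆ y∈)) (proj₂ (∈-filter⁻ outside? y∈)))

      inside↭orbit : filter (_∈? orbit x) (x ∷ L) ↭ orbit x
      inside↭orbit = unique-↭ (Unique.filter⁺ (_∈? orbit x) L!) (orbit-unique (per (here refl)))
        (λ z∈ → proj₂ (∈-filter⁻ (_∈? orbit x) z∈))
        (λ z∈ → ∈-filter⁺ (_∈? orbit x) (orbit-⊆ (here refl) closed z∈) z∈)

      split : s + length rest ≡ length (x ∷ L)
      split = trans (cong (_+ length rest) (sym (trans (↭-length inside↭orbit) (length-applyUpTo _ s))))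
                    (length-filter+length-filter-¬ (_∈? orbit x) (x ∷ L))

      rest< : length rest < length (x ∷ L)
      rest< = subst (length rest <_) split (+-monoˡ-≤ (length rest) (MinimalPeriod.positive (per (here refl))))

divisors : ℕ → List ℕ
divisors t = filter (_∣? t) (upFrom 1 t)

divisors-unique : ∀ t → Unique (divisors t)
divisors-unique t = Unique.filter⁺ (_∣? t) (upFrom-unique 1 t)

∈-divisors⁺ : ∀ {t u} → 1 ≤ t → u ∣ t → u ∈ divisors t
∈-divisors⁺ {t} {u} 1≤t u∣t = ∈-filter⁺ (_∣? t) (∈-upFrom⁺ 1≤u (s≤s (∣⇒≤′ 1≤t u∣t))) u∣t
  where
  1≤u : 1 ≤ u
  1≤u = n≢0⇒n>0 λ u≡0 → <⇒≢ 1≤t (sym (0∣⇒≡0 (subst (_∣ t) u≡0 u∣t)))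

∈-divisors⁻ : ∀ {t u} → u ∈ divisors t → u ∣ t
∈-divisors⁻ {t} u∈ = proj₂ (∈-filter⁻ (_∣? t) {xs = upFrom 1 t} u∈)

onCycle? : (g : List ℕ → List ℕ) → ∀ s c → Dec (onCycleOfLength g s c ≡ true)
onCycle? g s c = onCycleOfLength g s c ≟ᵇ true

onCycleOfLength-cong : ∀ {f g : List ℕ → List ℕ} {x y} → (∀ m → (iter f m x ≡ x) ⇔ (iter g m y ≡ y)) →
  ∀ s → (onCycleOfLength f s x ≡ true) ⇔ (onCycleOfLength g s y ≡ true)
onCycleOfLength-cong {f} {g} {x} {y} same s = mk⇔
  (λ on → Equivalence.from (onCycleOfLength≡true⇔ g y s) (minimalPeriod-cong (Equivalence.to ∘ same) (Equivalence.from ∘ same) (Equivalence.to (onCycleOfLength≡true⇔ f x s) on)))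
  (λ on → Equivalence.from (onCycleOfLength≡true⇔ f x s) (minimalPeriod-cong (Equivalence.from ∘ same) (Equivalence.to ∘ same) (Equivalence.to (onCycleOfLength≡true⇔ g y s) on)))

fixed? : (g : List ℕ → List ℕ) → ∀ t c → Dec (iter g t c ≡ c)
fixed? g t c = ≡-dec _≟_ (iter g t c) c

module _ (g : List ℕ → List ℕ) {t : ℕ} (1≤t : 1 ≤ t) where

  indicator-fixed≡sum-divisors : ∀ c → indicator (fixed? g t c) ≡ sum (map (λ u → indicator (onCycle? g u c)) (divisors t))
  indicator-fixed≡sum-divisors c with fixed? g t c
  ... | no ¬fixed = sym (sum-map-zero _ (divisors t) off)
    where
    off : ∀ {u} → u ∈ divisors t → indicator (onCycle? g u c) ≡ 0
    off {u} u∈ with onCycle? g u c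
    ... | no _   = refl
    ... | yes on = ⊥-elim (¬fixed (iter-∣-fixed g (MinimalPeriod.periodic (Equivalence.to (onCycleOfLength≡true⇔ g c u) on)) (∈-divisors⁻ {t} u∈)))
  ... | yes fixed with p , _ , per ← minimalPeriod-exists (≡-dec _≟_) 1≤t fixed =
    sym (trans (sum-map-single _ (divisors-unique t) (∈-divisors⁺ 1≤t (minimalPeriod-∣ per fixed)) off) on-p)
    where
    off : ∀ {u} → u ∈ divisors t → u ≢ p → indicator (onCycle? g u c) ≡ 0
    off {u} _ u≢p with onCycle? g u c
    ... | no _   = refl
    ... | yes on = ⊥-elim (u≢p (minimalPeriod-unique (Equivalence.to (onCycleOfLength≡true⇔ g c u) on) per))
    on-p : indicator (onCycle? g p c) ≡ 1
    on-p with onCycle? g p c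
    ... | yes _  = refl
    ... | no off = ⊥-elim (off (Equivalence.from (onCycleOfLength≡true⇔ g c p) per))

  fixedCount≡sum-divisors : ∀ xs → length (filter (fixed? g t) xs) ≡ sum (map (λ u → length (filter (onCycle? g u) xs)) (divisors t))
  fixedCount≡sum-divisors []       = sym (sum-map-zero _ (divisors t) (λ _ → refl))
  fixedCount≡sum-divisors (c ∷ xs) = begin
    length (filter (fixed? g t) (c ∷ xs))
      ≡⟨ length-filter-∷ (fixed? g t) c xs ⟩
    indicator (fixed? g t c) + length (filter (fixed? g t) xs)
      ≡⟨ cong₂ _+_ (indicator-fixed≡sum-divisors c) (fixedCount≡sum-divisors xs) ⟩
    sum (map (λ u → indicator (onCycle? g u c)) (divisors t)) + sum (map (λ u → length (filter (onCycle? g u) xs)) (divisors t))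
      ≡⟨ sym (sum-map-+ _ _ (divisors t)) ⟩
    sum (map (λ u → indicator (onCycle? g u c) + length (filter (onCycle? g u) xs)) (divisors t))
      ≡⟨ cong sum (map-cong (λ u → sym (length-filter-∷ (onCycle? g u) c xs)) (divisors t)) ⟩
    sum (map (λ u → length (filter (onCycle? g u) (c ∷ xs))) (divisors t))
      ∎
    where open ≡-Reasoning

-- Integer sums and the Möbius function

-- The fold of Defs.sumDivisors, so that sumDivisors t f unfolds to a Σℤ over range 1 t.
Σℤ : List ℕ → (ℕ → ℤ) → ℤ
Σℤ xs f = foldr (λ e acc → f e +ℤ acc) (+ 0) xs

Σℤ-↭ : ∀ f {xs ys} → xs ↭ ys → Σℤ xs f ≡ Σℤ ys f
Σℤ-↭ f ↭.refl           = refl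
Σℤ-↭ f (↭.prep x p)     = cong (f x +ℤ_) (Σℤ-↭ f p)
Σℤ-↭ f (↭.swap x y p) = trans (sym (ℤ.+-assoc (f x) (f y) _))
  (trans (cong₂ _+ℤ_ (ℤ.+-comm (f x) (f y)) (Σℤ-↭ f p)) (ℤ.+-assoc (f y) (f x) _))
Σℤ-↭ f (↭.trans p q)    = trans (Σℤ-↭ f p) (Σℤ-↭ f q)

Σℤ-map : ∀ (g : ℕ → ℕ) f xs → Σℤ (map g xs) f ≡ Σℤ xs (f ∘ g)
Σℤ-map g f []       = refl
Σℤ-map g f (x ∷ xs) = cong (f (g x) +ℤ_) (Σℤ-map g f xs)

Σℤ-cong : ∀ {f h} xs → (∀ {x} → x ∈ xs → f x ≡ h x) → Σℤ xs f ≡ Σℤ xs h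
Σℤ-cong []       _   = refl
Σℤ-cong (x ∷ xs) f≗h = cong₂ _+ℤ_ (f≗h (here refl)) (Σℤ-cong xs (f≗h ∘ there))

Σℤ-zero : ∀ f xs → (∀ {x} → x ∈ xs → f x ≡ + 0) → Σℤ xs f ≡ + 0
Σℤ-zero f []       _    = refl
Σℤ-zero f (x ∷ xs) f≡0 = cong₂ _+ℤ_ (f≡0 (here refl)) (Σℤ-zero f xs (f≡0 ∘ there))

Σℤ-neg : ∀ f xs → Σℤ xs (-_ ∘ f) ≡ - Σℤ xs f
Σℤ-neg f []       = refl
Σℤ-neg f (x ∷ xs) = trans (cong (- f x +ℤ_) (Σℤ-neg f xs)) (sym (ℤ.neg-distrib-+ (f x) _))

Σℤ-++ : ∀ f xs ys → Σℤ (xs ++ ys) f ≡ Σℤ xs f +ℤ Σℤ ys f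
Σℤ-++ f []       ys = sym (ℤ.+-identityˡ _)
Σℤ-++ f (x ∷ xs) ys = trans (cong (f x +ℤ_) (Σℤ-++ f xs ys)) (sym (ℤ.+-assoc (f x) _ _))

Σℤ-+ : ∀ f g xs → Σℤ xs (λ x → f x +ℤ g x) ≡ Σℤ xs f +ℤ Σℤ xs g
Σℤ-+ f g []       = refl
Σℤ-+ f g (x ∷ xs) = trans (cong (f x +ℤ g x +ℤ_) (Σℤ-+ f g xs)) (+ℤ-interchange (f x) (g x) _ _)

Σℤ-swap : ∀ (f : ℕ → ℕ → ℤ) xs ys → Σℤ xs (λ e → Σℤ ys (f e)) ≡ Σℤ ys (λ u → Σℤ xs (λ e → f e u))
Σℤ-swap f []       ys = sym (Σℤ-zero _ ys (λ _ → refl))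
Σℤ-swap f (x ∷ xs) ys = trans (cong (Σℤ ys (f x) +ℤ_) (Σℤ-swap f xs ys)) (sym (Σℤ-+ (f x) _ ys))

Σℤ-*ˡ : ∀ c f xs → Σℤ xs (λ x → c *ℤ f x) ≡ c *ℤ Σℤ xs f
Σℤ-*ˡ c f []       = sym (ℤ.*-zeroʳ c)
Σℤ-*ˡ c f (x ∷ xs) = trans (cong (c *ℤ f x +ℤ_) (Σℤ-*ˡ c f xs)) (sym (ℤ.*-distribˡ-+ c (f x) _))

Σℤ-*ʳ : ∀ c f xs → Σℤ xs (λ x → f x *ℤ c) ≡ Σℤ xs f *ℤ c
Σℤ-*ʳ c f xs = trans (Σℤ-cong xs (λ {x} _ → ℤ.*-comm (f x) c)) (trans (Σℤ-*ˡ c f xs) (ℤ.*-comm c _))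

Σℤ-if : ∀ {P : ℕ → Set} (P? : ∀ x → Dec (P x)) f xs → Σℤ xs (λ x → if ⌊ P? x ⌋ then f x else + 0) ≡ Σℤ (filter P? xs) f
Σℤ-if P? f []       = refl
Σℤ-if P? f (x ∷ xs) with P? x
... | yes _ = cong (f x +ℤ_) (Σℤ-if P? f xs)
... | no _  = trans (ℤ.+-identityˡ _) (Σℤ-if P? f xs)

Σℤ-single : ∀ f {p xs} → Unique xs → p ∈ xs → (∀ {u} → u ∈ xs → u ≢ p → f u ≡ + 0) → Σℤ xs f ≡ f p
Σℤ-single f (x∉xs ∷ _) (here refl) f≡0 =
  trans (cong (f _ +ℤ_) (Σℤ-zero f _ λ u∈xs → f≡0 (there u∈xs) (λ { refl → All.lookup x∉xs u∈xs refl }))) (ℤ.+-identityʳ _)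
Σℤ-single f {xs = x ∷ xs} (x∉xs ∷ xs!) (there p∈xs) f≡0 =
  trans (cong (_+ℤ Σℤ xs f) (f≡0 (here refl) λ { refl → All.lookup x∉xs p∈xs refl }))
        (trans (ℤ.+-identityˡ _) (Σℤ-single f xs! p∈xs (f≡0 ∘ there)))

Σℤ-upFrom-truncate : ∀ f {m M} → m ≤ M → (∀ x → m < x → f x ≡ + 0) → Σℤ (upFrom 1 M) f ≡ Σℤ (upFrom 1 m) f
Σℤ-upFrom-truncate f {m} {M} m≤M f≡0 = begin
  Σℤ (upFrom 1 M) f                                   ≡⟨ cong (λ c → Σℤ (upFrom 1 c) f) (sym (m+[n∸m]≡n m≤M)) ⟩
  Σℤ (upFrom 1 (m + (M ∸ m))) f                       ≡⟨ cong (λ xs → Σℤ xs f) (upFrom-++ 1 m (M ∸ m)) ⟩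
  Σℤ (upFrom 1 m ++ upFrom (1 + m) (M ∸ m)) f         ≡⟨ Σℤ-++ f (upFrom 1 m) _ ⟩
  Σℤ (upFrom 1 m) f +ℤ Σℤ (upFrom (1 + m) (M ∸ m)) f ≡⟨ cong (Σℤ (upFrom 1 m) f +ℤ_) (Σℤ-zero f (upFrom (1 + m) (M ∸ m)) (λ {x} x∈ → f≡0 x (proj₁ (∈-upFrom⁻ x∈)))) ⟩
  Σℤ (upFrom 1 m) f +ℤ + 0                           ≡⟨ ℤ.+-identityʳ _ ⟩
  Σℤ (upFrom 1 m) f                                   ∎
  where open ≡-Reasoning

+-sum-map : ∀ (h : ℕ → ℕ) xs → + sum (map h xs) ≡ Σℤ xs (λ u → + h u)
+-sum-map h []       = refl
+-sum-map h (x ∷ xs) = trans (ℤ.pos-+ (h x) _) (cong (_+ℤ_ (+ h x)) (+-sum-map h xs))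

x≡-x⇒x≡0 : ∀ {x} → x ≡ - x → x ≡ + 0
x≡-x⇒x≡0 {+ zero}  _  = refl
x≡-x⇒x≡0 {+ suc n} ()
x≡-x⇒x≡0 { -[1+ n ]} ()

unique-map : ∀ (f : ℕ → ℕ) {xs} → Unique xs → (∀ {x y} → x ∈ xs → y ∈ xs → f x ≡ f y → x ≡ y) → Unique (map f xs)
unique-map f {[]}     []          _   = []
unique-map f {x ∷ xs} (x∉xs ∷ xs!) inj = distinct x∉xs (λ y∈ → y∈) ∷ unique-map f xs! (λ x∈ y∈ → inj (there x∈) (there y∈))
  where
  distinct : ∀ {ys} → All (x ≢_) ys → (∀ {y} → y ∈ ys → y ∈ xs) → All (f x ≢_) (map f ys)
  distinct []           _   = []
  distinct (x≢y ∷ x≢ys) ys⊆ = (x≢y ∘ inj (here refl) (there (ys⊆ (here refl)))) ∷ distinct x≢ys (ys⊆ ∘ there)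

Σℤ-involution : ∀ (ι : ℕ → ℕ) f {xs} → Unique xs → (∀ {x} → x ∈ xs → ι x ∈ xs) → (∀ {x} → x ∈ xs → ι (ι x) ≡ x) →
  (∀ {x} → x ∈ xs → f (ι x) ≡ - f x) → Σℤ xs f ≡ + 0
Σℤ-involution ι f {xs} xs! closed involutive negates = x≡-x⇒x≡0 (begin
  Σℤ xs f          ≡⟨ sym (Σℤ-↭ f map-ι↭) ⟩
  Σℤ (map ι xs) f  ≡⟨ Σℤ-map ι f xs ⟩
  Σℤ xs (f ∘ ι)    ≡⟨ Σℤ-cong xs negates ⟩
  Σℤ xs (-_ ∘ f)   ≡⟨ Σℤ-neg f xs ⟩
  - Σℤ xs f        ∎)
  where
  open ≡-Reasoning
  map-ι↭ : map ι xs ↭ xs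
  map-ι↭ = unique-↭ (unique-map ι xs! (λ x∈ y∈ ιx≡ιy → trans (sym (involutive x∈)) (trans (cong ι ιx≡ιy) (involutive y∈)))) xs!
    (λ z∈ → let x , x∈ , z≡ιx = ∈-map⁻ ι z∈ in subst (_∈ xs) (sym z≡ιx) (closed x∈))
    (λ z∈ → subst (_∈ map ι xs) (involutive z∈) (∈-map⁺ ι (closed z∈)))

sumDivisors≡Σℤ : ∀ t f → sumDivisors t f ≡ Σℤ (upFrom 1 t) (λ e → if ⌊ e ∣? t ⌋ then f e else + 0)
sumDivisors≡Σℤ t f = cong (λ xs → Σℤ xs (λ e → if ⌊ e ∣? t ⌋ then f e else + 0)) (range≡upFrom 1 t)

prime⇒≥2 : ∀ {p} → Prime p → 2 ≤ p
prime⇒≥2 {p} pp = nonTrivial⇒n>1 p {{prime⇒nonTrivial pp}}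

primeDivisor : ∀ {m} → 2 ≤ m → Σ ℕ λ p → Prime p × p ∣ m
primeDivisor {m} 2≤m with factorise m {{>-nonZero (≤-trans (s≤s z≤n) 2≤m)}}
... | record { factors = []     ; isFactorisation = m≡1 }                         = ⊥-elim (<-irrefl (sym m≡1) 2≤m)
... | record { factors = p ∷ ps ; isFactorisation = m≡ ; factorsPrime = pp ∷ _ } = p , pp , divides (product ps) (trans m≡ (*-comm p _))

squarefree≡true⇔ : ∀ {n} → 1 ≤ n → squarefree n ≡ true ⇔ (∀ q → 2 ≤ q → ¬ q * q ∣ n)
squarefree≡true⇔ {n} 1≤n = mk⇔
  (λ sf q 2≤q qq∣n → Equivalence.to noSquare sf (subst (q ∈_) (sym (range≡upFrom 2 n)) (∈-upFrom⁺ 2≤q (q<2+[n∸1] q 2≤q qq∣n))) qq∣n)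
  (λ none → Equivalence.from noSquare λ {q} q∈ → none q (proj₁ (∈-upFrom⁻ (subst (q ∈_) (range≡upFrom 2 n) q∈))))
  where
  noSquare = foldr-not-∧≡true⇔ (λ d → (d * d) ∣? n) (range 2 n)
  q<2+[n∸1] : ∀ q → 2 ≤ q → q * q ∣ n → q < 2 + (n ∸ 1)
  q<2+[n∸1] q 2≤q qq∣n = subst (q <_) (cong suc (sym (m+[n∸m]≡n 1≤n)))
    (s≤s (≤-trans (m≤m*n q q {{>-nonZero (≤-trans (s≤s z≤n) 2≤q)}}) (∣⇒≤′ 1≤n qq∣n)))

coprime-square-prime : ∀ {r p} → Prime r → Prime p → r ≢ p → Coprime (r * r) p
coprime-square-prime {r} {p} pr pp r≢p {i} (i∣rr , i∣p) with prime⇒irreducible pp i∣p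
... | inj₁ i≡1 = i≡1
... | inj₂ refl = ⊥-elim (r≢p (sym (p≡r (euclidsLemma r r pp i∣rr))))
  where
  p≡r : p ∣ r ⊎ p ∣ r → p ≡ r
  p≡r p∣r⊎p∣r with prime⇒irreducible pr (reduce p∣r⊎p∣r)
  ... | inj₁ p≡1 = ⊥-elim (<-irrefl (sym p≡1) (prime⇒≥2 pp))
  ... | inj₂ p≡r = p≡r

squarefree-* : ∀ {p d} → Prime p → ¬ p ∣ d → 1 ≤ d → squarefree (p * d) ≡ squarefree d
squarefree-* {p} {d} pp p∤d 1≤d = ≡true⇔≡true⇒≡ (mk⇔ to from)
  where
  instance _ = >-nonZero (≤-trans (s≤s z≤n) (prime⇒≥2 pp))
  1≤pd : 1 ≤ p * d
  1≤pd = ≤-trans 1≤d (m≤n*m d p)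
  to : squarefree (p * d) ≡ true → squarefree d ≡ true
  to sf = Equivalence.from (squarefree≡true⇔ 1≤d) λ q 2≤q qq∣d → Equivalence.to (squarefree≡true⇔ 1≤pd) sf q 2≤q (∣n⇒∣m*n p qq∣d)
  noPrimeSquare : squarefree d ≡ true → ∀ {r} → Prime r → ¬ r * r ∣ p * d
  noPrimeSquare sf {r} pr rr∣pd with r ≟ p
  ... | yes refl = p∤d (*-cancelˡ-∣ r rr∣pd)
  ... | no r≢p     = Equivalence.to (squarefree≡true⇔ 1≤d) sf r (prime⇒≥2 pr) (coprime-divisor (coprime-square-prime pr pp r≢p) rr∣pd)
  from : squarefree d ≡ true → squarefree (p * d) ≡ true
  from sf = Equivalence.from (squarefree≡true⇔ 1≤pd) λ q 2≤q qq∣pd →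
    let r , pr , r∣q = primeDivisor 2≤q in noPrimeSquare sf pr (∣-trans (*-pres-∣ r∣q r∣q) qq∣pd)

primeDivisor? : ∀ n q → Dec (Prime q × q ∣ n)
primeDivisor? n q = prime? q ×-dec q ∣? n

numPrimeDivisors≡ : ∀ {n M} → 1 ≤ n → n ≤ M → numPrimeDivisors n ≡ length (filter (primeDivisor? n) (upFrom 2 (M ∸ 1)))
numPrimeDivisors≡ {n} {M} 1≤n n≤M = begin
  numPrimeDivisors n
    ≡⟨ length-filter-cong _ (primeDivisor? n) (range 2 n) (λ _ → asProduct) ⟩
  length (filter (primeDivisor? n) (range 2 n))
    ≡⟨ cong (length ∘ filter (primeDivisor? n)) (range≡upFrom 2 n) ⟩
  length (filter (primeDivisor? n) (upFrom 2 (n ∸ 1)))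
    ≡⟨ sym (+-identityʳ _) ⟩
  length (filter (primeDivisor? n) (upFrom 2 (n ∸ 1))) + 0
    ≡⟨ cong₂ _+_ refl (sym (length-filter-none (primeDivisor? n) (upFrom (2 + (n ∸ 1)) (M ∸ n)) beyond)) ⟩
  length (filter (primeDivisor? n) (upFrom 2 (n ∸ 1))) + length (filter (primeDivisor? n) (upFrom (2 + (n ∸ 1)) (M ∸ n)))
    ≡⟨ sym (length-filter-++ (primeDivisor? n) (upFrom 2 (n ∸ 1)) _) ⟩
  length (filter (primeDivisor? n) (upFrom 2 (n ∸ 1) ++ upFrom (2 + (n ∸ 1)) (M ∸ n)))
    ≡⟨ cong (length ∘ filter (primeDivisor? n)) (sym (upFrom-++ 2 (n ∸ 1) (M ∸ n))) ⟩
  length (filter (primeDivisor? n) (upFrom 2 (n ∸ 1 + (M ∸ n))))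
    ≡⟨ cong (λ m → length (filter (primeDivisor? n) (upFrom 2 m))) (M∸1≡ 1≤n n≤M) ⟩
  length (filter (primeDivisor? n) (upFrom 2 (M ∸ 1)))
    ∎
  where
  open ≡-Reasoning
  asProduct : ∀ {q} → (⌊ prime? q ⌋ ∧ ⌊ q ∣? n ⌋) ≡ true ⇔ (Prime q × q ∣ n)
  asProduct {q} = mk⇔
    (λ b → let b₁ , b₂ = Equivalence.to ∧≡true⇔ b in Equivalence.to (⌊⌋≡true⇔ (prime? q)) b₁ , Equivalence.to (⌊⌋≡true⇔ (q ∣? n)) b₂)
    (λ (pq , q∣n) → Equivalence.from ∧≡true⇔ (Equivalence.from (⌊⌋≡true⇔ (prime? q)) pq , Equivalence.from (⌊⌋≡true⇔ (q ∣? n)) q∣n))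
  beyond : ∀ {q} → q ∈ upFrom (2 + (n ∸ 1)) (M ∸ n) → ¬ (Prime q × q ∣ n)
  beyond {q} q∈ (_ , q∣n) = <-irrefl refl (≤-trans (subst (_≤ q) (cong suc (m+[n∸m]≡n 1≤n)) (proj₁ (∈-upFrom⁻ q∈))) (∣⇒≤′ 1≤n q∣n))
  M∸1≡ : ∀ {n M} → 1 ≤ n → n ≤ M → n ∸ 1 + (M ∸ n) ≡ M ∸ 1
  M∸1≡ {suc n} {suc M} _ (s≤s n≤M) = m+[n∸m]≡n n≤M

numPrimeDivisors-* : ∀ {p d} → Prime p → ¬ p ∣ d → 1 ≤ d → numPrimeDivisors (p * d) ≡ suc (numPrimeDivisors d)
numPrimeDivisors-* {p} {d} pp p∤d 1≤d = begin
  numPrimeDivisors (p * d)                                                      ≡⟨ numPrimeDivisors≡ 1≤pd ≤-refl ⟩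
  length (filter (primeDivisor? (p * d)) U)                                      ≡⟨ length-filter≡sum-indicator (primeDivisor? (p * d)) U ⟩
  sum (map (indicator ∘ primeDivisor? (p * d)) U)                                ≡⟨ cong sum (map-cong split U) ⟩
  sum (map (λ q → indicator (primeDivisor? d q) + indicator (q ≟ p)) U)          ≡⟨ sum-map-+ _ _ U ⟩
  sum (map (indicator ∘ primeDivisor? d) U) + sum (map (indicator ∘ (_≟ p)) U)   ≡⟨ cong₂ _+_ (sym (length-filter≡sum-indicator (primeDivisor? d) U)) p-once ⟩
  length (filter (primeDivisor? d) U) + 1                                        ≡⟨ cong (_+ 1) (sym (numPrimeDivisors≡ 1≤d (m≤n*m d p))) ⟩
  numPrimeDivisors d + 1                                                         ≡⟨ +-comm _ 1 ⟩
  suc (numPrimeDivisors d)                                                       ∎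
  where
  open ≡-Reasoning
  instance _ = >-nonZero (≤-trans (s≤s z≤n) (prime⇒≥2 pp))
  U = upFrom 2 (p * d ∸ 1)
  1≤pd : 1 ≤ p * d
  1≤pd = ≤-trans 1≤d (m≤n*m d p)
  p-once : sum (map (indicator ∘ (_≟ p)) U) ≡ 1
  p-once = trans (sum-map-single _ (upFrom-unique 2 _) (∈-upFrom⁺ (prime⇒≥2 pp) p<) (λ {u} _ u≢p → ind-no u u≢p)) ind-yes
    where
    p< : p < 2 + (p * d ∸ 1)
    p< = subst (p <_) (cong suc (sym (m+[n∸m]≡n 1≤pd))) (s≤s (m≤m*n p d {{>-nonZero 1≤d}}))
    ind-yes : indicator (p ≟ p) ≡ 1
    ind-yes with p ≟ p
    ... | yes _   = refl
    ... | no p≢p = ⊥-elim (p≢p refl)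
    ind-no : ∀ u → u ≢ p → indicator (u ≟ p) ≡ 0
    ind-no u u≢p with u ≟ p
    ... | yes u≡p = ⊥-elim (u≢p u≡p)
    ... | no _    = refl
  split : ∀ q → indicator (primeDivisor? (p * d) q) ≡ indicator (primeDivisor? d q) + indicator (q ≟ p)
  split q with primeDivisor? (p * d) q | primeDivisor? d q | q ≟ p
  ... | no _          | no _             | no _     = refl
  ... | no ¬pd        | yes (pq , q∣d)   | _        = ⊥-elim (¬pd (pq , ∣n⇒∣m*n p q∣d))
  ... | no ¬pd        | no _             | yes refl = ⊥-elim (¬pd (pp , ∣m⇒∣m*n d ∣-refl))
  ... | yes _         | yes _            | no _     = refl
  ... | yes _         | yes (_ , p∣d)    | yes refl = ⊥-elim (p∤d p∣d)
  ... | yes _         | no _             | yes _    = refl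
  ... | yes (pq , q∣pd) | no ¬d          | no q≢p with euclidsLemma p d pq q∣pd
  ...   | inj₂ q∣d = ⊥-elim (¬d (pq , q∣d))
  ...   | inj₁ q∣p with prime⇒irreducible pp q∣p
  ...     | inj₁ q≡1 = ⊥-elim (<-irrefl (sym q≡1) (prime⇒≥2 pq))
  ...     | inj₂ q≡p = ⊥-elim (q≢p q≡p)

μ-* : ∀ {p d} → Prime p → ¬ p ∣ d → 1 ≤ d → μ (p * d) ≡ - μ d
μ-* {d = d} pp p∤d 1≤d rewrite squarefree-* pp p∤d 1≤d | numPrimeDivisors-* pp p∤d 1≤d with squarefree d
... | true  = refl
... | false = refl

μ-nonSquarefree : ∀ {d} → squarefree d ≡ false → μ d ≡ + 0
μ-nonSquarefree {d} nsf rewrite nsf = refl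

module _ {m p : ℕ} (1≤m : 1 ≤ m) (pp : Prime p) (p∣m : p ∣ m) where
  private
    instance _ = >-nonZero (≤-trans (s≤s z≤n) (prime⇒≥2 pp))

    SquarefreeDivisor : ℕ → Set
    SquarefreeDivisor e = 1 ≤ e × e ∣ m × squarefree e ≡ true

    squarefreeDivisor? : ∀ e → Dec (SquarefreeDivisor e)
    squarefreeDivisor? e = (1 ≤? e) ×-dec (e ∣? m) ×-dec (squarefree e ≟ᵇ true)

    ι : ℕ → ℕ
    ι e = if ⌊ p ∣? e ⌋ then e / p else p * e

    ι-∣ : ∀ {e} → p ∣ e → ι e ≡ e / p
    ι-∣ {e} p∣e with p ∣? e
    ... | yes _   = refl
    ... | no p∤e = ⊥-elim (p∤e p∣e)

    ι-∤ : ∀ {e} → ¬ p ∣ e → ι e ≡ p * e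
    ι-∤ {e} p∤e with p ∣? e
    ... | yes p∣e = ⊥-elim (p∤e p∣e)
    ... | no _    = refl

    record Paired (e : ℕ) : Set where
      field
        partner    : SquarefreeDivisor (ι e)
        involutive : ι (ι e) ≡ e
        sign-flip  : μ (ι e) ≡ - μ e

    paired-∣ : ∀ {e} → SquarefreeDivisor e → p ∣ e → Paired e
    paired-∣ {e} (1≤e , e∣m , sf) p∣e = record
      { partner    = subst SquarefreeDivisor (sym (ι-∣ p∣e)) (1≤e′ , ∣-trans (divides p (sym pe′≡e)) e∣m , sf′)
      ; involutive = trans (cong ι (ι-∣ p∣e)) (trans (ι-∤ p∤e′) pe′≡e)
      ; sign-flip  = trans (cong μ (ι-∣ p∣e)) (trans (sym (ℤ.neg-involutive (μ e′))) (cong -_ (sym (trans (cong μ (sym pe′≡e)) (μ-* pp p∤e′ 1≤e′)))))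
      }
      where
      e′ = e / p
      pe′≡e : p * e′ ≡ e
      pe′≡e = m*[n/m]≡n p∣e
      p∤e′ : ¬ p ∣ e′
      p∤e′ p∣e′ = Equivalence.to (squarefree≡true⇔ 1≤e) sf p (prime⇒≥2 pp) (subst (p * p ∣_) pe′≡e (*-monoʳ-∣ p p∣e′))
      1≤e′ : 1 ≤ e′
      1≤e′ = *-positiveʳ p (subst (1 ≤_) (sym pe′≡e) 1≤e)
      sf′ : squarefree e′ ≡ true
      sf′ = trans (sym (squarefree-* pp p∤e′ 1≤e′)) (trans (cong squarefree pe′≡e) sf)

    paired-∤ : ∀ {e} → SquarefreeDivisor e → ¬ p ∣ e → Paired e
    paired-∤ {e} (1≤e , e∣m , sf) p∤e = record
      { partner    = subst SquarefreeDivisor (sym (ι-∤ p∤e)) (≤-trans 1≤e (m≤n*m e p) , pe∣m , trans (squarefree-* pp p∤e 1≤e) sf)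
      ; involutive = trans (cong ι (ι-∤ p∤e)) (trans (ι-∣ (∣m⇒∣m*n e ∣-refl)) (trans (cong (_/ p) (*-comm p e)) (m*n/n≡m e p)))
      ; sign-flip  = trans (cong μ (ι-∤ p∤e)) (μ-* pp p∤e 1≤e)
      }
      where
      coprime : Coprime e p
      coprime {i} (i∣e , i∣p) with prime⇒irreducible pp i∣p
      ... | inj₁ i≡1 = i≡1
      ... | inj₂ refl = ⊥-elim (p∤e i∣e)
      pe∣m : p * e ∣ m
      pe∣m = subst (p * e ∣_) (m*[n/m]≡n p∣m) (*-monoʳ-∣ p (coprime-divisor coprime (subst (e ∣_) (sym (m*[n/m]≡n p∣m)) e∣m)))

    paired : ∀ {e} → SquarefreeDivisor e → Paired e
    paired {e} sd with p ∣? e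
    ... | yes p∣e = paired-∣ sd p∣e
    ... | no p∤e  = paired-∤ sd p∤e

  sumDivisors-μ-vanishes : sumDivisors m μ ≡ + 0
  sumDivisors-μ-vanishes = begin
    sumDivisors m μ                                                      ≡⟨ sumDivisors≡Σℤ m μ ⟩
    Σℤ (upFrom 1 m) (λ e → if ⌊ e ∣? m ⌋ then μ e else + 0)              ≡⟨ Σℤ-cong (upFrom 1 m) (λ e∈ → only-squarefree (proj₁ (∈-upFrom⁻ e∈))) ⟩
    Σℤ (upFrom 1 m) (λ e → if ⌊ squarefreeDivisor? e ⌋ then μ e else + 0) ≡⟨ Σℤ-if squarefreeDivisor? μ (upFrom 1 m) ⟩
    Σℤ L μ                                                               ≡⟨ Σℤ-involution ι μ (Unique.filter⁺ squarefreeDivisor? (upFrom-unique 1 m))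
                                                                              (λ e∈ → ∈L (Paired.partner (paired (∈L⁻ e∈))))
                                                                              (λ e∈ → Paired.involutive (paired (∈L⁻ e∈)))
                                                                              (λ e∈ → Paired.sign-flip (paired (∈L⁻ e∈))) ⟩
    + 0                                                                  ∎
    where
    open ≡-Reasoning
    L = filter squarefreeDivisor? (upFrom 1 m)
    ∈L⁻ : ∀ {e} → e ∈ L → SquarefreeDivisor e
    ∈L⁻ e∈ = proj₂ (∈-filter⁻ squarefreeDivisor? {xs = upFrom 1 m} e∈)
    ∈L : ∀ {e} → SquarefreeDivisor e → e ∈ L
    ∈L sd@(1≤e , e∣m , _) = ∈-filter⁺ squarefreeDivisor? (∈-upFrom⁺ 1≤e (s≤s (∣⇒≤′ 1≤m e∣m))) sd
    only-squarefree : ∀ {e} → 1 ≤ e → (if ⌊ e ∣? m ⌋ then μ e else + 0) ≡ (if ⌊ squarefreeDivisor? e ⌋ then μ e else + 0)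
    only-squarefree {e} 1≤e with 1 ≤? e | e ∣? m | squarefree e ≟ᵇ true
    ... | no 1≰e | _     | _     = ⊥-elim (1≰e 1≤e)
    ... | yes _  | no _  | _     = refl
    ... | yes _  | yes _ | yes _ = refl
    ... | yes _  | yes _ | no ¬sf = μ-nonSquarefree {e} (¬-not ¬sf)

sumDivisors-μ : ∀ {m} → 2 ≤ m → sumDivisors m μ ≡ + 0
sumDivisors-μ 2≤m with p , pp , p∣m ← primeDivisor 2≤m = sumDivisors-μ-vanishes (≤-trans (s≤s z≤n) 2≤m) pp p∣m

-- Möbius inversion

∣×∣div⇔*∣ : ∀ {e u s} → 1 ≤ e → (e ∣ s × u ∣ s div e) ⇔ e * u ∣ s
∣×∣div⇔*∣ {e} {u} {s} 1≤e = mk⇔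
  (λ (e∣s , u∣s/e) → subst (e * u ∣_) (div-cancelˡ 1≤e e∣s) (*-monoʳ-∣ e u∣s/e))
  (λ eu∣s → m*n∣⇒m∣ e u eu∣s , *-∣⇒∣div 1≤e eu∣s)

∣×∣div-comm : ∀ {e u s} → 1 ≤ e → 1 ≤ u → (e ∣ s × u ∣ s div e) ⇔ (u ∣ s × e ∣ s div u)
∣×∣div-comm {e} {u} {s} 1≤e 1≤u = mk⇔
  (λ h → Equivalence.from (∣×∣div⇔*∣ 1≤u) (subst (_∣ s) (*-comm e u) (Equivalence.to (∣×∣div⇔*∣ 1≤e) h)))
  (λ h → Equivalence.from (∣×∣div⇔*∣ 1≤e) (subst (_∣ s) (*-comm u e) (Equivalence.to (∣×∣div⇔*∣ 1≤u) h)))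

if-*ℤ : ∀ b c x → c *ℤ (if b then x else + 0) ≡ (if b then c *ℤ x else + 0)
if-*ℤ true  c x = refl
if-*ℤ false c x = ℤ.*-zeroʳ c

nested-if-cong : ∀ {A B C D : Set} {x : ℤ} → ((A × B) ⇔ (C × D)) → (a : Dec A) (b : Dec B) (c : Dec C) (d : Dec D) →
  (if ⌊ a ⌋ then (if ⌊ b ⌋ then x else + 0) else + 0) ≡ (if ⌊ c ⌋ then (if ⌊ d ⌋ then x else + 0) else + 0)
nested-if-cong eqv (yes a)  (yes b)  (yes c)  (yes d)  = refl
nested-if-cong eqv (yes a)  (yes b)  (no ¬c)  _        = ⊥-elim (¬c (proj₁ (Equivalence.to eqv (a , b))))
nested-if-cong eqv (yes a)  (yes b)  (yes c)  (no ¬d)  = ⊥-elim (¬d (proj₂ (Equivalence.to eqv (a , b))))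
nested-if-cong eqv (no ¬a)  _        (yes c)  (yes d)  = ⊥-elim (¬a (proj₁ (Equivalence.from eqv (c , d))))
nested-if-cong eqv (yes a)  (no ¬b)  (yes c)  (yes d)  = ⊥-elim (¬b (proj₂ (Equivalence.from eqv (c , d))))
nested-if-cong eqv (no _)   _        (no _)   _        = refl
nested-if-cong eqv (no _)   _        (yes _)  (no _)   = refl
nested-if-cong eqv (yes _)  (no _)   (no _)   _        = refl
nested-if-cong eqv (yes _)  (no _)   (yes _)  (no _)   = refl

module _ (N : ℕ → ℤ) {s : ℕ} (1≤s : 1 ≤ s) where
  private
    -- Nonzero only on pairs with e · u ∣ s: summed by rows it gives the left-hand side, and by columns only u = s survives.
    entry : ℕ → ℕ → ℤ
    entry e u = if ⌊ e ∣? s ⌋ then (if ⌊ u ∣? s div e ⌋ then μ e *ℤ N u else + 0) else + 0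

    entry-swap : ∀ {e u} → 1 ≤ e → 1 ≤ u → entry e u ≡ (if ⌊ u ∣? s ⌋ then (if ⌊ e ∣? s div u ⌋ then μ e *ℤ N u else + 0) else + 0)
    entry-swap {e} {u} 1≤e 1≤u = nested-if-cong (∣×∣div-comm 1≤e 1≤u) (e ∣? s) (u ∣? s div e) (u ∣? s) (e ∣? s div u)

    entry-∤ : ∀ {e u} → 1 ≤ e → 1 ≤ u → ¬ u ∣ s → entry e u ≡ + 0
    entry-∤ {e} {u} 1≤e 1≤u u∤s with entry-swap {e} {u} 1≤e 1≤u
    ... | swapped with u ∣? s
    ...   | yes u∣s = ⊥-elim (u∤s u∣s)
    ...   | no _    = swapped

    entry-∣ : ∀ {e u} → 1 ≤ e → 1 ≤ u → u ∣ s → entry e u ≡ (if ⌊ e ∣? s div u ⌋ then μ e else + 0) *ℤ N u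
    entry-∣ {e} {u} 1≤e 1≤u u∣s with entry-swap {e} {u} 1≤e 1≤u
    ... | swapped with u ∣? s | e ∣? s div u
    ...   | no u∤s | _     = ⊥-elim (u∤s u∣s)
    ...   | yes _  | yes _ = swapped
    ...   | yes _  | no _  = swapped

    vanishes-beyond : ∀ {t} (f : ℕ → ℤ) → 1 ≤ t → ∀ u → t < u → (if ⌊ u ∣? t ⌋ then f u else + 0) ≡ + 0
    vanishes-beyond {t} f 1≤t u t<u with u ∣? t
    ... | no _    = refl
    ... | yes u∣t = ⊥-elim (<-irrefl refl (<-≤-trans t<u (∣⇒≤′ 1≤t u∣t)))

    row : ∀ {e} → 1 ≤ e → (if ⌊ e ∣? s ⌋ then μ e *ℤ sumDivisors (s div e) N else + 0) ≡ Σℤ (upFrom 1 s) (entry e)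
    row {e} 1≤e with e ∣? s
    ... | no _    = sym (Σℤ-zero _ (upFrom 1 s) (λ _ → refl))
    ... | yes e∣s = begin
      μ e *ℤ sumDivisors (s div e) N
        ≡⟨ cong (μ e *ℤ_) (sumDivisors≡Σℤ (s div e) N) ⟩
      μ e *ℤ Σℤ (upFrom 1 (s div e)) (λ u → if ⌊ u ∣? s div e ⌋ then N u else + 0)
        ≡⟨ sym (Σℤ-*ˡ (μ e) _ (upFrom 1 (s div e))) ⟩
      Σℤ (upFrom 1 (s div e)) (λ u → μ e *ℤ (if ⌊ u ∣? s div e ⌋ then N u else + 0))
        ≡⟨ Σℤ-cong (upFrom 1 (s div e)) (λ {u} _ → if-*ℤ ⌊ u ∣? s div e ⌋ (μ e) (N u)) ⟩
      Σℤ (upFrom 1 (s div e)) (λ u → if ⌊ u ∣? s div e ⌋ then μ e *ℤ N u else + 0)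
        ≡⟨ sym (Σℤ-upFrom-truncate _ (div-≤ s 1≤e) (vanishes-beyond (λ u → μ e *ℤ N u) (div-positive 1≤e 1≤s e∣s))) ⟩
      Σℤ (upFrom 1 s) (λ u → if ⌊ u ∣? s div e ⌋ then μ e *ℤ N u else + 0)
        ∎
      where open ≡-Reasoning

    column-∣ : ∀ {u} → 1 ≤ u → u ∣ s → Σℤ (upFrom 1 s) (λ e → entry e u) ≡ sumDivisors (s div u) μ *ℤ N u
    column-∣ {u} 1≤u u∣s = begin
      Σℤ (upFrom 1 s) (λ e → entry e u)
        ≡⟨ Σℤ-cong (upFrom 1 s) (λ e∈ → entry-∣ (proj₁ (∈-upFrom⁻ e∈)) 1≤u u∣s) ⟩
      Σℤ (upFrom 1 s) (λ e → (if ⌊ e ∣? s div u ⌋ then μ e else + 0) *ℤ N u)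
        ≡⟨ Σℤ-*ʳ (N u) (λ e → if ⌊ e ∣? s div u ⌋ then μ e else + 0) (upFrom 1 s) ⟩
      Σℤ (upFrom 1 s) (λ e → if ⌊ e ∣? s div u ⌋ then μ e else + 0) *ℤ N u
        ≡⟨ cong (_*ℤ N u) (Σℤ-upFrom-truncate _ (div-≤ s 1≤u) (vanishes-beyond μ (div-positive 1≤u 1≤s u∣s))) ⟩
      Σℤ (upFrom 1 (s div u)) (λ e → if ⌊ e ∣? s div u ⌋ then μ e else + 0) *ℤ N u
        ≡⟨ cong (_*ℤ N u) (sym (sumDivisors≡Σℤ (s div u) μ)) ⟩
      sumDivisors (s div u) μ *ℤ N u
        ∎
      where open ≡-Reasoning

  möbius-inversion : sumDivisors s (λ e → μ e *ℤ sumDivisors (s div e) N) ≡ N s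
  möbius-inversion = begin
    sumDivisors s (λ e → μ e *ℤ sumDivisors (s div e) N)
      ≡⟨ sumDivisors≡Σℤ s _ ⟩
    Σℤ (upFrom 1 s) (λ e → if ⌊ e ∣? s ⌋ then μ e *ℤ sumDivisors (s div e) N else + 0)
      ≡⟨ Σℤ-cong (upFrom 1 s) (λ e∈ → row (proj₁ (∈-upFrom⁻ e∈))) ⟩
    Σℤ (upFrom 1 s) (λ e → Σℤ (upFrom 1 s) (entry e))
      ≡⟨ Σℤ-swap entry (upFrom 1 s) (upFrom 1 s) ⟩
    Σℤ (upFrom 1 s) (λ u → Σℤ (upFrom 1 s) (λ e → entry e u))
      ≡⟨ Σℤ-single _ (upFrom-unique 1 s) (∈-upFrom⁺ 1≤s (s≤s ≤-refl)) off-diagonal ⟩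
    Σℤ (upFrom 1 s) (λ e → entry e s)
      ≡⟨ column-∣ 1≤s ∣-refl ⟩
    sumDivisors (s div s) μ *ℤ N s
      ≡⟨ cong (λ t → sumDivisors t μ *ℤ N s) (div-self 1≤s) ⟩
    + 1 *ℤ N s
      ≡⟨ ℤ.*-identityˡ (N s) ⟩
    N s
      ∎
    where
    open ≡-Reasoning
    off-diagonal : ∀ {u} → u ∈ upFrom 1 s → u ≢ s → Σℤ (upFrom 1 s) (λ e → entry e u) ≡ + 0
    off-diagonal {u} u∈ u≢s with 1≤u ← proj₁ (∈-upFrom⁻ u∈) with u ∣? s
    ... | no u∤s  = Σℤ-zero _ (upFrom 1 s) (λ e∈ → entry-∤ (proj₁ (∈-upFrom⁻ e∈)) 1≤u u∤s)
    ... | yes u∣s = trans (column-∣ 1≤u u∣s) (cong (_*ℤ N u) (sumDivisors-μ 2≤s/u))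
      where
      2≤s/u : 2 ≤ s div u
      2≤s/u with s div u in eq | div-positive 1≤u 1≤s u∣s
      ... | suc zero    | _ = ⊥-elim (u≢s (trans (sym (*-identityʳ u)) (trans (cong (u *_) (sym eq)) (div-cancelˡ 1≤u u∣s))))
      ... | suc (suc _) | _ = s≤s (s≤s z≤n)

multiplicity : ℕ → List ℕ → ℕ
multiplicity i []       = 0
multiplicity i (y ∷ ys) = if ⌊ i ≟ y ⌋ then suc (multiplicity i ys) else multiplicity i ys

multiplicity-here : ∀ i ys → multiplicity i (i ∷ ys) ≡ suc (multiplicity i ys)
multiplicity-here i ys with i ≟ i
... | yes _ = refl
... | no i≢i = ⊥-elim (i≢i refl)

multiplicity-here>0 : ∀ i ys → 0 < multiplicity i (i ∷ ys)
multiplicity-here>0 i ys = subst (0 <_) (sym (multiplicity-here i ys)) (s≤s z≤n)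

multiplicity-there : ∀ {i y} ys → i ≢ y → multiplicity i (y ∷ ys) ≡ multiplicity i ys
multiplicity-there {i} {y} ys i≢y with i ≟ y
... | yes i≡y = ⊥-elim (i≢y i≡y)
... | no _    = refl

multiplicity-swap : ∀ i x y ys → multiplicity i (x ∷ y ∷ ys) ≡ multiplicity i (y ∷ x ∷ ys)
multiplicity-swap i x y ys with i ≟ x | i ≟ y
... | yes _ | yes _ = refl
... | yes _ | no _  = refl
... | no _  | yes _ = refl
... | no _  | no _  = refl

multiplicity-∷ : ∀ i x ys zs → multiplicity i ys ≡ multiplicity i zs → multiplicity i (x ∷ ys) ≡ multiplicity i (x ∷ zs)
multiplicity-∷ i x _ _ eq with i ≟ x
... | yes _ = cong suc eq
... | no _  = eq

multiplicity-∷-cancel : ∀ i x ys zs → multiplicity i (x ∷ ys) ≡ multiplicity i (x ∷ zs) → multiplicity i ys ≡ multiplicity i zs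
multiplicity-∷-cancel i x _ _ eq with i ≟ x
... | yes _ = suc-injective eq
... | no _  = eq

multiplicity-insert : ∀ i x ys → multiplicity i (insert x ys) ≡ multiplicity i (x ∷ ys)
multiplicity-insert i x []       = refl
multiplicity-insert i x (y ∷ ys) with x ≤ᵇ y
... | true  = refl
... | false = trans (multiplicity-∷ i y (insert x ys) (x ∷ ys) (multiplicity-insert i x ys)) (multiplicity-swap i y x ys)

multiplicity-sortℕ : ∀ i xs → multiplicity i (sortℕ xs) ≡ multiplicity i xs
multiplicity-sortℕ i []       = refl
multiplicity-sortℕ i (x ∷ xs) = trans (multiplicity-insert i x (sortℕ xs)) (multiplicity-∷ i x (sortℕ xs) xs (multiplicity-sortℕ i xs))

multiplicity-absent : ∀ i xs → All (i <_) xs → multiplicity i xs ≡ 0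
multiplicity-absent i []       []         = refl
multiplicity-absent i (y ∷ ys) (i<y ∷ i<ys) = trans (multiplicity-there ys (<⇒≢ i<y)) (multiplicity-absent i ys i<ys)

multiplicity>0⇒∈ : ∀ {P : ℕ → Set} i xs → All P xs → 0 < multiplicity i xs → P i
multiplicity>0⇒∈ i (y ∷ ys) (py ∷ pys) m>0 with i ≟ y
... | yes refl = py
... | no _     = multiplicity>0⇒∈ i ys pys m>0

data Sorted : List ℕ → Set where
  []  : Sorted []
  _∷_ : ∀ {x xs} → All (x ≤_) xs → Sorted xs → Sorted (x ∷ xs)

All-insert : ∀ {P : ℕ → Set} {x} ys → P x → All P ys → All P (insert x ys)
All-insert []                px []         = px ∷ []
All-insert {x = x} (y ∷ ys) px (py ∷ pys) with x ≤ᵇ y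
... | true  = px ∷ py ∷ pys
... | false = py ∷ All-insert ys px pys

insert-sorted : ∀ x {ys} → Sorted ys → Sorted (insert x ys)
insert-sorted x []                        = [] ∷ []
insert-sorted x {y ∷ ys} (y≤ys ∷ ys-sorted) with x ≤ᵇ y in x≤ᵇy
... | true  = (x≤y ∷ All.map (≤-trans x≤y) y≤ys) ∷ y≤ys ∷ ys-sorted
  where x≤y = ≤ᵇ⇒≤ x y (subst T (sym x≤ᵇy) _)
... | false = All-insert ys (<⇒≤ (≰⇒> λ x≤y → subst T x≤ᵇy (≤⇒≤ᵇ x≤y))) y≤ys ∷ insert-sorted x ys-sorted

sortℕ-sorted : ∀ xs → Sorted (sortℕ xs)
sortℕ-sorted []       = []
sortℕ-sorted (x ∷ xs) = insert-sorted x (sortℕ-sorted xs)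

sorted-unique : ∀ {xs ys} → Sorted xs → Sorted ys → (∀ i → multiplicity i xs ≡ multiplicity i ys) → xs ≡ ys
sorted-unique []         []         _   = refl
sorted-unique {[]} {y ∷ ys} [] (_ ∷ _) same with () ← subst (0 <_) (sym (same y)) (multiplicity-here>0 y ys)
sorted-unique {x ∷ xs} {[]} (_ ∷ _) [] same with () ← subst (0 <_) (same x) (multiplicity-here>0 x xs)
sorted-unique {x ∷ xs} {y ∷ ys} (x≤xs ∷ xs-sorted) (y≤ys ∷ ys-sorted) same = cong₂ _∷_ x≡y (sorted-unique xs-sorted ys-sorted same′)
  where
  y≤x : y ≤ x
  y≤x = multiplicity>0⇒∈ x (y ∷ ys) (≤-refl ∷ y≤ys) (subst (0 <_) (same x) (multiplicity-here>0 x xs))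
  x≤y : x ≤ y
  x≤y = multiplicity>0⇒∈ y (x ∷ xs) (≤-refl ∷ x≤xs) (subst (0 <_) (sym (same y)) (multiplicity-here>0 y ys))
  x≡y = ≤-antisym x≤y y≤x
  same′ : ∀ i → multiplicity i xs ≡ multiplicity i ys
  same′ i = multiplicity-∷-cancel i x xs ys (trans (same i) (cong (λ z → multiplicity i (z ∷ ys)) (sym x≡y)))

-- Weak compositions

incHead : List ℕ → List ℕ
incHead []      = []
incHead (a ∷ c) = suc a ∷ c

compositions : ℕ → ℕ → List (List ℕ)
compositions m       zero    = replicate m 0 ∷ []
compositions zero    (suc k) = []
compositions (suc m) (suc k) = map incHead (compositions (suc m) k) ++ map (0 ∷_) (compositions m (suc k))

IsComposition : ℕ → ℕ → List ℕ → Set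
IsComposition m k c = length c ≡ m × sum c ≡ k

sum-replicate-0 : ∀ m → sum (replicate m 0) ≡ 0
sum-replicate-0 zero    = refl
sum-replicate-0 (suc m) = sum-replicate-0 m

sum≡0⇒replicate : ∀ c → sum c ≡ 0 → c ≡ replicate (length c) 0
sum≡0⇒replicate []       _    = refl
sum≡0⇒replicate (zero ∷ c) Σc≡0 = cong (0 ∷_) (sum≡0⇒replicate c Σc≡0)

compositions-isComposition : ∀ m k → All (IsComposition m k) (compositions m k)
compositions-isComposition m       zero    = (length-replicate m , sum-replicate-0 m) ∷ []
compositions-isComposition zero    (suc k) = []
compositions-isComposition (suc m) (suc k) =
  ++⁺ (map⁺ (All.map (λ {c} → incHead-isComposition {c}) (compositions-isComposition (suc m) k)))
      (map⁺ (All.map (λ {c} (len , total) → cong suc len , total) (compositions-isComposition m (suc k))))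
  where
  incHead-isComposition : ∀ {c} → IsComposition (suc m) k c → IsComposition (suc m) (suc k) (incHead c)
  incHead-isComposition {a ∷ c} (len , total) = len , cong suc total

∈-compositions⁻ : ∀ {m k c} → c ∈ compositions m k → IsComposition m k c
∈-compositions⁻ {m} {k} = All.lookup (compositions-isComposition m k)

∈-compositions⁺ : ∀ m k c → IsComposition m k c → c ∈ compositions m k
∈-compositions⁺ m       zero    c          (len , total) = here (trans (sum≡0⇒replicate c total) (cong (λ l → replicate l 0) len))
∈-compositions⁺ zero    (suc k) []         (_ , ())
∈-compositions⁺ (suc m) (suc k) (zero ∷ c) (len , total) =
  ∈-++⁺ʳ (map incHead (compositions (suc m) k)) (∈-map⁺ (0 ∷_) (∈-compositions⁺ m (suc k) c (suc-injective len , total)))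
∈-compositions⁺ (suc m) (suc k) (suc a ∷ c) (len , total) =
  ∈-++⁺ˡ (∈-map⁺ incHead (∈-compositions⁺ (suc m) k (a ∷ c) (len , suc-injective total)))

incHead-injective : ∀ {x y} → incHead x ≡ incHead y → x ≡ y
incHead-injective {[]}    {[]}    _    = refl
incHead-injective {a ∷ x} {b ∷ y} refl = refl

compositions-unique : ∀ m k → Unique (compositions m k)
compositions-unique m       zero    = [] ∷ []
compositions-unique zero    (suc k) = []
compositions-unique (suc m) (suc k) =
  Unique.++⁺ (Unique.map⁺ incHead-injective (compositions-unique (suc m) k)) (Unique.map⁺ (λ { refl → refl }) (compositions-unique m (suc k))) disjoint
  where
  disjoint : ∀ {z} → z ∈ map incHead (compositions (suc m) k) × z ∈ map (0 ∷_) (compositions m (suc k)) → ⊥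
  disjoint (z∈₁ , z∈₂) with ∈-map⁻ incHead z∈₁ | ∈-map⁻ (0 ∷_) z∈₂
  ... | c , c∈ , refl | _ , _ , eq with ∈-compositions⁻ {suc m} {k} c∈
  ...   | len , _ with c | eq
  ...     | _ ∷ _ | ()

length-compositions : ∀ m k → length (compositions (suc m) k) ≡ (m + k) C m
length-compositions m       zero    = trans (sym (nCn≡1 m)) (cong (_C m) (sym (+-identityʳ m)))
length-compositions zero    (suc k) = trans (cong length (++-identityʳ (map incHead (compositions 1 k)))) (trans (length-map incHead (compositions 1 k)) (length-compositions zero k))
length-compositions (suc m) (suc k) = begin
  length (map incHead (compositions (suc (suc m)) k) ++ map (0 ∷_) (compositions (suc m) (suc k)))
    ≡⟨ length-++ (map incHead (compositions (suc (suc m)) k)) ⟩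
  length (map incHead (compositions (suc (suc m)) k)) + length (map (0 ∷_) (compositions (suc m) (suc k)))
    ≡⟨ cong₂ _+_ (length-map incHead (compositions (suc (suc m)) k)) (length-map (0 ∷_) (compositions (suc m) (suc k))) ⟩
  length (compositions (suc (suc m)) k) + length (compositions (suc m) (suc k))
    ≡⟨ cong₂ _+_ (length-compositions (suc m) k) (length-compositions m (suc k)) ⟩
  (suc m + k) C suc m + (m + suc k) C m
    ≡⟨ cong (λ z → z C suc m + (m + suc k) C m) (sym (+-suc m k)) ⟩
  (m + suc k) C suc m + (m + suc k) C m
    ≡⟨ +-comm ((m + suc k) C suc m) _ ⟩
  (m + suc k) C m + (m + suc k) C suc m
    ≡⟨ nCk+nC[k+1]≡[n+1]C[k+1] (m + suc k) m ⟩
  (suc m + suc k) C suc m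
    ∎
  where open ≡-Reasoning

length-compositions-1 : ∀ m → length (compositions m 1) ≡ m
length-compositions-1 zero    = refl
length-compositions-1 (suc m) = trans (length-++ (map incHead (compositions (suc m) 0)) {map (0 ∷_) (compositions m 1)})
  (cong suc (trans (length-map (0 ∷_) (compositions m 1)) (length-compositions-1 m)))

multiplicities : ℕ → ℕ → List ℕ → List ℕ
multiplicities a m x = map (λ i → multiplicity i x) (upFrom a m)

IncreasingIn : ℕ → ℕ → ℕ → List ℕ → Set
IncreasingIn lo n k x = Sorted x × All (λ i → lo ≤ i × i ≤ n) x × length x ≡ k

incFrom-≤ : ∀ {lo n} k → lo ≤ n → incFrom lo n (suc k) ≡ map (lo ∷_) (incFrom lo n k) ++ incFrom (suc lo) n (suc k)
incFrom-≤ k lo≤n rewrite range-≤ lo≤n = refl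

incFrom-> : ∀ {lo n} k → n < lo → incFrom lo n (suc k) ≡ []
incFrom-> k n<lo rewrite range-> n<lo = refl

module _ {lo n m : ℕ} (width : suc n ∸ lo ≡ suc m) where

  nonempty : lo ≤ n
  nonempty = ≤-pred (m∸n≢0⇒n<m (λ eq → 0≢1+n (trans (sym eq) width)))

  narrower : suc n ∸ suc lo ≡ m
  narrower = suc-injective (trans (sym (+-∸-assoc 1 nonempty)) width)

incFrom-increasing : ∀ k m {lo n} → suc n ∸ lo ≡ m → All (IncreasingIn lo n k) (incFrom lo n k)
incFrom-increasing zero    m       _     = ([] , [] , refl) ∷ []
incFrom-increasing (suc k) zero {lo} {n} width rewrite incFrom-> {lo} {n} k (m∸n≡0⇒m≤n width) = []
incFrom-increasing (suc k) (suc m) {lo} {n} width rewrite incFrom-≤ {lo} {n} k (nonempty {lo} {n} width) =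
  ++⁺ (map⁺ (All.map (λ (sorted , bounded , len) → All.map proj₁ bounded ∷ sorted , (≤-refl , nonempty {lo} {n} width) ∷ bounded , cong suc len)
                     (incFrom-increasing k (suc m) width)))
      (All.map (λ (sorted , bounded , len) → sorted , All.map (λ (lo< , ≤n) → <⇒≤ lo< , ≤n) bounded , len)
               (incFrom-increasing (suc k) m (narrower {lo} {n} width)))

multiplicities-[] : ∀ a m → multiplicities a m [] ≡ replicate m 0
multiplicities-[] a zero    = refl
multiplicities-[] a (suc m) = cong (0 ∷_) (multiplicities-[] (suc a) m)

map-multiplicities-incFrom : ∀ k m {lo n} → suc n ∸ lo ≡ m → map (multiplicities lo m) (incFrom lo n k) ≡ compositions m k
map-multiplicities-incFrom zero    m       {lo} _     = cong (_∷ []) (multiplicities-[] lo m)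
map-multiplicities-incFrom (suc k) zero {lo} {n} width rewrite incFrom-> {lo} {n} k (m∸n≡0⇒m≤n width) = refl
map-multiplicities-incFrom (suc k) (suc m) {lo} {n} width = begin
    map (multiplicities lo (suc m)) (incFrom lo n (suc k))
      ≡⟨ cong (map (multiplicities lo (suc m))) (incFrom-≤ {lo} {n} k (nonempty {lo} {n} width)) ⟩
    map (multiplicities lo (suc m)) (map (lo ∷_) (incFrom lo n k) ++ incFrom (suc lo) n (suc k))
      ≡⟨ map-++ (multiplicities lo (suc m)) (map (lo ∷_) (incFrom lo n k)) _ ⟩
    map (multiplicities lo (suc m)) (map (lo ∷_) (incFrom lo n k)) ++ map (multiplicities lo (suc m)) (incFrom (suc lo) n (suc k))
      ≡⟨ cong₂ _++_ starting-at-lo starting-above-lo ⟩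
    map incHead (compositions (suc m) k) ++ map (0 ∷_) (compositions m (suc k))
      ∎
  where
  open ≡-Reasoning
  add-lo : ∀ y → multiplicities lo (suc m) (lo ∷ y) ≡ incHead (multiplicities lo (suc m) y)
  add-lo y = cong₂ _∷_ (multiplicity-here lo y)
    (map-cong-local (All.map (λ (lo< , _) → multiplicity-there y (λ i≡lo → <-irrefl (sym i≡lo) lo<)) (upFrom-bounded (suc lo) m)))
  starting-at-lo : map (multiplicities lo (suc m)) (map (lo ∷_) (incFrom lo n k)) ≡ map incHead (compositions (suc m) k)
  starting-at-lo = begin
    map (multiplicities lo (suc m)) (map (lo ∷_) (incFrom lo n k)) ≡⟨ sym (map-∘ (incFrom lo n k)) ⟩
    map (λ y → multiplicities lo (suc m) (lo ∷ y)) (incFrom lo n k) ≡⟨ map-cong add-lo (incFrom lo n k) ⟩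
    map (incHead ∘′ multiplicities lo (suc m)) (incFrom lo n k)     ≡⟨ map-∘ (incFrom lo n k) ⟩
    map incHead (map (multiplicities lo (suc m)) (incFrom lo n k))  ≡⟨ cong (map incHead) (map-multiplicities-incFrom k (suc m) width) ⟩
    map incHead (compositions (suc m) k)                            ∎
  lo-absent : ∀ {z} → IncreasingIn (suc lo) n (suc k) z → multiplicities lo (suc m) z ≡ 0 ∷ multiplicities (suc lo) m z
  lo-absent {z} (_ , bounded , _) = cong (_∷ multiplicities (suc lo) m z) (multiplicity-absent lo z (All.map proj₁ bounded))
  starting-above-lo : map (multiplicities lo (suc m)) (incFrom (suc lo) n (suc k)) ≡ map (0 ∷_) (compositions m (suc k))
  starting-above-lo = begin
    map (multiplicities lo (suc m)) (incFrom (suc lo) n (suc k))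
      ≡⟨ map-cong-local (All.map lo-absent (incFrom-increasing (suc k) m (narrower {lo} {n} width))) ⟩
    map ((0 ∷_) ∘′ multiplicities (suc lo) m) (incFrom (suc lo) n (suc k))
      ≡⟨ map-∘ (incFrom (suc lo) n (suc k)) ⟩
    map (0 ∷_) (map (multiplicities (suc lo) m) (incFrom (suc lo) n (suc k)))
      ≡⟨ cong (map (0 ∷_)) (map-multiplicities-incFrom (suc k) m (narrower {lo} {n} width)) ⟩
    map (0 ∷_) (compositions m (suc k))
      ∎

map-multiplicities-Cnk : ∀ n k → map (multiplicities 1 n) (Cnk n k) ≡ compositions n k
map-multiplicities-Cnk n k = map-multiplicities-incFrom k n refl

Cnk-increasing : ∀ n k → All (IncreasingIn 1 n k) (Cnk n k)
Cnk-increasing n k = incFrom-increasing k n refl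

-- The ℓ-cycle acting on multiplicity vectors

lcycle-< : ∀ {ℓ y} → 1 ≤ y → y < ℓ → lcycle ℓ y ≡ suc y
lcycle-< 1≤y y<ℓ rewrite Equivalence.to T-≡ (≤⇒≤ᵇ 1≤y) | Equivalence.to T-≡ (<⇒<ᵇ y<ℓ) = refl

lcycle-≡ : ∀ {ℓ} → 1 ≤ ℓ → lcycle ℓ ℓ ≡ 1
lcycle-≡ {ℓ} 1≤ℓ rewrite Equivalence.to T-≡ (≤⇒≤ᵇ 1≤ℓ) | ¬T⇒≡false (λ t → <-irrefl refl (<ᵇ⇒< ℓ ℓ t)) | Equivalence.to T-≡ (≡⇒≡ᵇ ℓ ℓ refl) = refl

lcycle-> : ∀ {ℓ y} → ℓ < y → lcycle ℓ y ≡ y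
lcycle-> {ℓ} {y} ℓ<y rewrite ¬T⇒≡false (λ t → <-asym ℓ<y (<ᵇ⇒< y ℓ t)) | ¬T⇒≡false (λ t → <-irrefl (sym (≡ᵇ⇒≡ y ℓ t)) ℓ<y) with 1 ≤ᵇ y
... | true  = refl
... | false = refl

lcycle-0 : ∀ {ℓ} → 1 ≤ ℓ → lcycle ℓ 0 ≡ 0
lcycle-0 {suc _} _ = refl

lcycle⁻¹ : ℕ → ℕ → ℕ
lcycle⁻¹ ℓ zero          = zero
lcycle⁻¹ ℓ (suc zero)    = ℓ
lcycle⁻¹ ℓ (suc (suc j)) = if suc (suc j) ≤ᵇ ℓ then suc j else suc (suc j)

lcycle⁻¹-≤ : ∀ {ℓ j} → suc (suc j) ≤ ℓ → lcycle⁻¹ ℓ (suc (suc j)) ≡ suc j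
lcycle⁻¹-≤ 2+j≤ℓ rewrite Equivalence.to T-≡ (≤⇒≤ᵇ 2+j≤ℓ) = refl

lcycle⁻¹-> : ∀ {ℓ j} → ℓ < suc (suc j) → lcycle⁻¹ ℓ (suc (suc j)) ≡ suc (suc j)
lcycle⁻¹-> {ℓ} ℓ<2+j rewrite ¬T⇒≡false (λ t → <-irrefl refl (<-≤-trans ℓ<2+j (≤ᵇ⇒≤ _ ℓ t))) = refl

lcycle⁻¹-lcycle : ∀ {ℓ} → 1 ≤ ℓ → ∀ y → lcycle⁻¹ ℓ (lcycle ℓ y) ≡ y
lcycle⁻¹-lcycle {ℓ} 1≤ℓ zero rewrite lcycle-0 1≤ℓ = refl
lcycle⁻¹-lcycle {ℓ} 1≤ℓ (suc y) with <-cmp (suc y) ℓ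
... | tri< y<ℓ _ _ rewrite lcycle-< (s≤s z≤n) y<ℓ = lcycle⁻¹-≤ y<ℓ
... | tri≈ _ refl _ rewrite lcycle-≡ 1≤ℓ = refl
... | tri> _ _ ℓ<y rewrite lcycle-> ℓ<y with y
...   | zero   = ⊥-elim (<-irrefl refl (≤-trans ℓ<y 1≤ℓ))
...   | suc _  = lcycle⁻¹-> ℓ<y

lcycle-lcycle⁻¹ : ∀ {ℓ} → 1 ≤ ℓ → ∀ i → lcycle ℓ (lcycle⁻¹ ℓ i) ≡ i
lcycle-lcycle⁻¹ 1≤ℓ zero          = lcycle-0 1≤ℓ
lcycle-lcycle⁻¹ 1≤ℓ (suc zero)    = lcycle-≡ 1≤ℓ
lcycle-lcycle⁻¹ {ℓ} 1≤ℓ (suc (suc j)) with suc (suc j) ≤? ℓ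
... | yes 2+j≤ℓ rewrite lcycle⁻¹-≤ 2+j≤ℓ = lcycle-< (s≤s z≤n) 2+j≤ℓ
... | no 2+j≰ℓ  rewrite lcycle⁻¹-> (≰⇒> 2+j≰ℓ) = lcycle-> (≰⇒> 2+j≰ℓ)

multiplicity-map-lcycle : ∀ {ℓ} → 1 ≤ ℓ → ∀ i x → multiplicity i (map (lcycle ℓ) x) ≡ multiplicity (lcycle⁻¹ ℓ i) x
multiplicity-map-lcycle 1≤ℓ i [] = refl
multiplicity-map-lcycle {ℓ} 1≤ℓ i (y ∷ ys) with i ≟ lcycle ℓ y | lcycle⁻¹ ℓ i ≟ y
... | yes _     | yes _     = cong suc (multiplicity-map-lcycle 1≤ℓ i ys)
... | no _      | no _      = multiplicity-map-lcycle 1≤ℓ i ys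
... | yes i≡σy  | no σ⁻¹i≢y = ⊥-elim (σ⁻¹i≢y (trans (cong (lcycle⁻¹ ℓ) i≡σy) (lcycle⁻¹-lcycle 1≤ℓ y)))
... | no i≢σy   | yes σ⁻¹i≡y = ⊥-elim (i≢σy (trans (sym (lcycle-lcycle⁻¹ 1≤ℓ i)) (cong (lcycle ℓ) σ⁻¹i≡y)))

multiplicity-symPow : ∀ {ℓ} → 1 ≤ ℓ → ∀ i x → multiplicity i (symPow (lcycle ℓ) x) ≡ multiplicity (lcycle⁻¹ ℓ i) x
multiplicity-symPow 1≤ℓ i x = trans (multiplicity-sortℕ i (map (lcycle _) x)) (multiplicity-map-lcycle 1≤ℓ i x)

lastOf : ℕ → List ℕ → ℕ
lastOf x []       = x
lastOf x (y ∷ ys) = lastOf y ys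

initOf : ℕ → List ℕ → List ℕ
initOf x []       = []
initOf x (y ∷ ys) = x ∷ initOf y ys

rotateRight : List ℕ → List ℕ
rotateRight []       = []
rotateRight (x ∷ xs) = lastOf x xs ∷ initOf x xs

rotateLeft : List ℕ → List ℕ
rotateLeft []       = []
rotateLeft (x ∷ xs) = xs ∷ʳ x

lastOf-∷ʳ : ∀ x ys z → lastOf x (ys ∷ʳ z) ≡ z
lastOf-∷ʳ x []       z = refl
lastOf-∷ʳ x (y ∷ ys) z = lastOf-∷ʳ y ys z

initOf-∷ʳ : ∀ x ys z → initOf x (ys ∷ʳ z) ≡ x ∷ ys
initOf-∷ʳ x []       z = refl
initOf-∷ʳ x (y ∷ ys) z = cong (x ∷_) (initOf-∷ʳ y ys z)

initOf-∷ʳ-lastOf : ∀ x xs → initOf x xs ∷ʳ lastOf x xs ≡ x ∷ xs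
initOf-∷ʳ-lastOf x []       = refl
initOf-∷ʳ-lastOf x (y ∷ ys) = cong (x ∷_) (initOf-∷ʳ-lastOf y ys)

length-initOf : ∀ x xs → length (initOf x xs) ≡ length xs
length-initOf x []       = refl
length-initOf x (y ∷ ys) = cong suc (length-initOf y ys)

rotateRight-∷ʳ : ∀ ys z → rotateRight (ys ∷ʳ z) ≡ z ∷ ys
rotateRight-∷ʳ []       z = refl
rotateRight-∷ʳ (y ∷ ys) z = cong₂ _∷_ (lastOf-∷ʳ y ys z) (initOf-∷ʳ y ys z)

rotateLeft-rotateRight : ∀ c → rotateLeft (rotateRight c) ≡ c
rotateLeft-rotateRight []       = refl
rotateLeft-rotateRight (x ∷ xs) = initOf-∷ʳ-lastOf x xs

rotateRight-rotateLeft : ∀ c → rotateRight (rotateLeft c) ≡ c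
rotateRight-rotateLeft []       = refl
rotateRight-rotateLeft (x ∷ xs) = rotateRight-∷ʳ xs x

length-rotateRight : ∀ c → length (rotateRight c) ≡ length c
length-rotateRight []       = refl
length-rotateRight (x ∷ xs) = cong suc (length-initOf x xs)

rotatePrefix : ℕ → List ℕ → List ℕ
rotatePrefix ℓ c = rotateRight (take ℓ c) ++ drop ℓ c

multiplicities-map-lcycle : ∀ {ℓ n} → 1 ≤ ℓ → ℓ ≤ n → ∀ x →
  multiplicities 1 n (map (lcycle ℓ) x) ≡ rotatePrefix ℓ (multiplicities 1 n x)
multiplicities-map-lcycle {suc L} {n} _ ℓ≤n x = begin
  map (λ i → multiplicity i (map (lcycle ℓ) x)) (upFrom 1 n)
    ≡⟨ map-cong (λ i → multiplicity-map-lcycle (s≤s z≤n) i x) (upFrom 1 n) ⟩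
  map (mult ∘ lcycle⁻¹ ℓ) (upFrom 1 n)
    ≡⟨ cong (map (mult ∘ lcycle⁻¹ ℓ)) (trans (cong (upFrom 1) (sym (m+[n∸m]≡n ℓ≤n))) (upFrom-++ 1 ℓ r)) ⟩
  map (mult ∘ lcycle⁻¹ ℓ) (1 ∷ upFrom 2 L ++ upFrom (suc ℓ) r)
    ≡⟨ cong (mult ℓ ∷_) (map-++ (mult ∘ lcycle⁻¹ ℓ) (upFrom 2 L) _) ⟩
  mult ℓ ∷ map (mult ∘ lcycle⁻¹ ℓ) (upFrom 2 L) ++ map (mult ∘ lcycle⁻¹ ℓ) (upFrom (suc ℓ) r)
    ≡⟨ cong₂ (λ u v → mult ℓ ∷ u ++ v) shifted fixed ⟩
  mult ℓ ∷ map mult (upFrom 1 L) ++ map mult (upFrom (suc ℓ) r)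
    ≡⟨ cong (_++ map mult (upFrom (suc ℓ) r)) (sym (rotateRight-∷ʳ (map mult (upFrom 1 L)) (mult ℓ))) ⟩
  rotateRight (map mult (upFrom 1 L) ∷ʳ mult ℓ) ++ map mult (upFrom (suc ℓ) r)
    ≡⟨ cong (λ c → rotateRight c ++ map mult (upFrom (suc ℓ) r)) (sym prefix) ⟩
  rotateRight (map mult (upFrom 1 ℓ)) ++ map mult (upFrom (suc ℓ) r)
    ≡⟨ cong₂ (λ u v → rotateRight u ++ v) (sym (take-prefix _)) (sym (drop-prefix _)) ⟩
  rotatePrefix ℓ (map mult (upFrom 1 ℓ) ++ map mult (upFrom (suc ℓ) r))
    ≡⟨ cong (rotatePrefix ℓ) (sym (map-++ mult (upFrom 1 ℓ) _)) ⟩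
  rotatePrefix ℓ (map mult (upFrom 1 ℓ ++ upFrom (suc ℓ) r))
    ≡⟨ cong (rotatePrefix ℓ ∘ map mult) (trans (sym (upFrom-++ 1 ℓ r)) (cong (upFrom 1) (m+[n∸m]≡n ℓ≤n))) ⟩
  rotatePrefix ℓ (map mult (upFrom 1 n))
    ∎
  where
  open ≡-Reasoning
  ℓ = suc L
  r = n ∸ ℓ
  mult : ℕ → ℕ
  mult i = multiplicity i x
  shifted : map (mult ∘ lcycle⁻¹ ℓ) (upFrom 2 L) ≡ map mult (upFrom 1 L)
  shifted = begin
    map (mult ∘ lcycle⁻¹ ℓ) (upFrom 2 L) ≡⟨ map-cong-local (All.map (λ { {suc zero} (s≤s () , _) ; {suc (suc j)} (_ , j<L) → cong mult (lcycle⁻¹-≤ (≤-pred j<L)) }) (upFrom-bounded 2 L)) ⟩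
    map (mult ∘ pred) (upFrom 2 L)       ≡⟨ map-∘ (upFrom 2 L) ⟩
    map mult (map pred (upFrom 2 L))     ≡⟨ cong (map mult) (map-pred-upFrom 1 L) ⟩
    map mult (upFrom 1 L)                ∎
  fixed : map (mult ∘ lcycle⁻¹ ℓ) (upFrom (suc ℓ) r) ≡ map mult (upFrom (suc ℓ) r)
  fixed = map-cong-local (All.map (λ { {suc zero} (s≤s () , _) ; {suc (suc j)} (ℓ<i , _) → cong mult (lcycle⁻¹-> ℓ<i) }) (upFrom-bounded (suc ℓ) r))
  prefix : map mult (upFrom 1 ℓ) ≡ map mult (upFrom 1 L) ∷ʳ mult ℓ
  prefix = trans (cong (map mult) (trans (cong (upFrom 1) (+-comm 1 L)) (upFrom-++ 1 L 1))) (map-++ mult (upFrom 1 L) _)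
  length-prefix : length (map mult (upFrom 1 ℓ)) ≡ ℓ
  length-prefix = trans (length-map mult (upFrom 1 ℓ)) (length-upFrom 1 ℓ)
  take-prefix : ∀ v → take ℓ (map mult (upFrom 1 ℓ) ++ v) ≡ map mult (upFrom 1 ℓ)
  take-prefix v = subst (λ z → take z (map mult (upFrom 1 ℓ) ++ v) ≡ map mult (upFrom 1 ℓ)) length-prefix (take-length-++ (map mult (upFrom 1 ℓ)) v)
  drop-prefix : ∀ v → drop ℓ (map mult (upFrom 1 ℓ) ++ v) ≡ v
  drop-prefix v = subst (λ z → drop z (map mult (upFrom 1 ℓ) ++ v) ≡ v) length-prefix (drop-length-++ (map mult (upFrom 1 ℓ)) v)

module _ {ℓ n : ℕ} (1≤ℓ : 1 ≤ ℓ) (ℓ≤n : ℓ ≤ n) where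
  private
    σ = symPow (lcycle ℓ)
    R = rotatePrefix ℓ
    mults = multiplicities 1 n

  multiplicities-symPow : ∀ x → mults (σ x) ≡ R (mults x)
  multiplicities-symPow x = trans (map-cong (λ i → multiplicity-sortℕ i (map (lcycle ℓ) x)) (upFrom 1 n)) (multiplicities-map-lcycle 1≤ℓ ℓ≤n x)

  multiplicity-iter-symPow : ∀ m i x → multiplicity i (iter σ m x) ≡ multiplicity (iter (lcycle⁻¹ ℓ) m i) x
  multiplicity-iter-symPow zero    i x = refl
  multiplicity-iter-symPow (suc m) i x = trans (multiplicity-symPow 1≤ℓ i (iter σ m x))
    (trans (multiplicity-iter-symPow m (lcycle⁻¹ ℓ i) x) (cong (λ j → multiplicity j x) (iter-step (lcycle⁻¹ ℓ) m i)))

  iter-symPow-sorted : ∀ m {x} → Sorted x → Sorted (iter σ m x)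
  iter-symPow-sorted zero    sorted = sorted
  iter-symPow-sorted (suc m) {x} _  = sortℕ-sorted (map (lcycle ℓ) (iter σ m x))

  iter-symPow-fixed⇔ : ∀ m {x} → Sorted x → (iter σ m x ≡ x) ⇔ (iter R m (mults x) ≡ mults x)
  iter-symPow-fixed⇔ m {x} sorted = mk⇔
    (λ fixed → trans (sym (iter-homomorphic mults multiplicities-symPow m x)) (cong mults fixed))
    (λ fixed → sorted-unique (iter-symPow-sorted m sorted) sorted (same-multiplicity (trans (iter-homomorphic mults multiplicities-symPow m x) fixed)))
    where
    same-multiplicity : mults (iter σ m x) ≡ mults x → ∀ i → multiplicity i (iter σ m x) ≡ multiplicity i x
    same-multiplicity _ zero = trans (multiplicity-iter-symPow m 0 x) (cong (λ j → multiplicity j x) (iter-fixed (lcycle⁻¹ ℓ) m refl))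
    same-multiplicity eq (suc i) with suc i ≤? n
    ... | yes i<n = map-≡-∈ eq (∈-upFrom⁺ (s≤s z≤n) (s≤s i<n))
    ... | no i≮n with i
    ...   | zero   = ⊥-elim (i≮n (≤-trans 1≤ℓ ℓ≤n))
    ...   | suc j  = trans (multiplicity-iter-symPow m (suc (suc j)) x)
                       (cong (λ j → multiplicity j x) (iter-fixed (lcycle⁻¹ ℓ) m (lcycle⁻¹-> (<-≤-trans (s≤s ℓ≤n) (≰⇒> i≮n)))))

cyclePoints : ℕ → ℕ → ℕ → ℕ → ℕ
cyclePoints ℓ s n k = length (filter (onCycle? (rotatePrefix ℓ) s) (compositions n k))

Cls≡cyclePoints-div : ∀ {ℓ n} s k → 1 ≤ ℓ → ℓ ≤ n → Cls ℓ s n k ≡ cyclePoints ℓ s n k div s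
Cls≡cyclePoints-div {ℓ} {n} s k 1≤ℓ ℓ≤n = cong (_div s) (begin
  length (filter (onCycle? (symPow (lcycle ℓ)) s) (Cnk n k))
    ≡⟨ length-filter-map (onCycle? (symPow (lcycle ℓ)) s) (onCycle? (rotatePrefix ℓ) s) (multiplicities 1 n) (Cnk n k)
         (λ x∈ → onCycleOfLength-cong (λ m → iter-symPow-fixed⇔ 1≤ℓ ℓ≤n m (proj₁ (All.lookup (Cnk-increasing n k) x∈))) s) ⟩
  length (filter (onCycle? (rotatePrefix ℓ) s) (map (multiplicities 1 n) (Cnk n k)))
    ≡⟨ cong (length ∘ filter (onCycle? (rotatePrefix ℓ) s)) (map-multiplicities-Cnk n k) ⟩
  cyclePoints ℓ s n k
    ∎)
  where open ≡-Reasoning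

-- Recursion in n and k

length-rotatePrefix : ∀ ℓ c → length (rotatePrefix ℓ c) ≡ length c
length-rotatePrefix ℓ c = begin
  length (rotateRight (take ℓ c) ++ drop ℓ c)         ≡⟨ length-++ (rotateRight (take ℓ c)) ⟩
  length (rotateRight (take ℓ c)) + length (drop ℓ c) ≡⟨ cong (_+ length (drop ℓ c)) (length-rotateRight (take ℓ c)) ⟩
  length (take ℓ c) + length (drop ℓ c)               ≡⟨ sym (length-++ (take ℓ c)) ⟩
  length (take ℓ c ++ drop ℓ c)                       ≡⟨ cong length (take++drop≡id ℓ c) ⟩
  length c                                            ∎
  where open ≡-Reasoning

sum-rotateLeft : ∀ c → sum (rotateLeft c) ≡ sum c
sum-rotateLeft []       = refl
sum-rotateLeft (x ∷ xs) = trans (sum-++ xs (x ∷ [])) (trans (cong (_+_ (sum xs)) (+-identityʳ x)) (+-comm (sum xs) x))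

sum-rotateRight : ∀ c → sum (rotateRight c) ≡ sum c
sum-rotateRight c = trans (sym (sum-rotateLeft (rotateRight c))) (cong sum (rotateLeft-rotateRight c))

sum-rotatePrefix : ∀ ℓ c → sum (rotatePrefix ℓ c) ≡ sum c
sum-rotatePrefix ℓ c = begin
  sum (rotateRight (take ℓ c) ++ drop ℓ c)      ≡⟨ sum-++ (rotateRight (take ℓ c)) _ ⟩
  sum (rotateRight (take ℓ c)) + sum (drop ℓ c) ≡⟨ cong (_+ sum (drop ℓ c)) (sum-rotateRight (take ℓ c)) ⟩
  sum (take ℓ c) + sum (drop ℓ c)               ≡⟨ sym (sum-++ (take ℓ c) _) ⟩
  sum (take ℓ c ++ drop ℓ c)                    ≡⟨ cong sum (take++drop≡id ℓ c) ⟩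
  sum c                                         ∎
  where open ≡-Reasoning

rotatePrefix-compositions : ∀ ℓ {n k c} → c ∈ compositions n k → rotatePrefix ℓ c ∈ compositions n k
rotatePrefix-compositions ℓ {n} {k} {c} c∈ with len , total ← ∈-compositions⁻ c∈ =
  ∈-compositions⁺ n k (rotatePrefix ℓ c) (trans (length-rotatePrefix ℓ c) len , trans (sum-rotatePrefix ℓ c) total)

length-iter-rotatePrefix : ∀ ℓ m c → length (iter (rotatePrefix ℓ) m c) ≡ length c
length-iter-rotatePrefix ℓ zero    c = refl
length-iter-rotatePrefix ℓ (suc m) c = trans (length-rotatePrefix ℓ _) (length-iter-rotatePrefix ℓ m c)

rotatePrefix-∷ʳ : ∀ {ℓ c} a → ℓ ≤ length c → rotatePrefix ℓ (c ∷ʳ a) ≡ rotatePrefix ℓ c ∷ʳ a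
rotatePrefix-∷ʳ {ℓ} {c} a ℓ≤ rewrite take-++-≤ ℓ c (a ∷ []) ℓ≤ | drop-++-≤ ℓ c (a ∷ []) ℓ≤ =
  sym (++-assoc (rotateRight (take ℓ c)) (drop ℓ c) (a ∷ []))

iter-rotatePrefix-∷ʳ : ∀ {ℓ c} a m → ℓ ≤ length c → iter (rotatePrefix ℓ) m (c ∷ʳ a) ≡ iter (rotatePrefix ℓ) m c ∷ʳ a
iter-rotatePrefix-∷ʳ         a zero    ℓ≤ = refl
iter-rotatePrefix-∷ʳ {ℓ} {c} a (suc m) ℓ≤ = trans (cong (rotatePrefix ℓ) (iter-rotatePrefix-∷ʳ a m ℓ≤))
  (rotatePrefix-∷ʳ a (subst (ℓ ≤_) (sym (length-iter-rotatePrefix ℓ m c)) ℓ≤))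

onCycle-∷ʳ : ∀ {ℓ c} s a → ℓ ≤ length c →
  (onCycleOfLength (rotatePrefix ℓ) s (c ∷ʳ a) ≡ true) ⇔ (onCycleOfLength (rotatePrefix ℓ) s c ≡ true)
onCycle-∷ʳ {ℓ} {c} s a ℓ≤ = onCycleOfLength-cong (λ m → mk⇔
  (λ fixed → ∷ʳ-injectiveˡ _ c (trans (sym (iter-rotatePrefix-∷ʳ a m ℓ≤)) fixed))
  (λ fixed → trans (iter-rotatePrefix-∷ʳ a m ℓ≤) (cong (_∷ʳ a) fixed))) s

incLast : List ℕ → List ℕ
incLast []       = []
incLast (x ∷ xs) = initOf x xs ∷ʳ suc (lastOf x xs)

incLast-∷ʳ : ∀ u b → incLast (u ∷ʳ b) ≡ u ∷ʳ suc b
incLast-∷ʳ []      b = refl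
incLast-∷ʳ (y ∷ u) b = cong₂ (λ v c → v ∷ʳ suc c) (initOf-∷ʳ y u b) (lastOf-∷ʳ y u b)

∷ʳ≢[] : ∀ (u : List ℕ) a → u ∷ʳ a ≢ []
∷ʳ≢[] []      a ()
∷ʳ≢[] (_ ∷ _) a ()

length-∷ʳ : ∀ (u : List ℕ) a → length (u ∷ʳ a) ≡ suc (length u)
length-∷ʳ u a = trans (length-++ u) (+-comm (length u) 1)

sum-∷ʳ : ∀ u a → sum (u ∷ʳ a) ≡ sum u + a
sum-∷ʳ u a = trans (sum-++ u (a ∷ [])) (cong (_+_ (sum u)) (+-identityʳ a))

incLast-injective : ∀ {x y} → incLast x ≡ incLast y → x ≡ y
incLast-injective {x} {y} eq with initLast x | initLast y
... | []       | []       = refl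
... | []       | v ∷ʳ′ b  = ⊥-elim (∷ʳ≢[] v (suc b) (sym (trans eq (incLast-∷ʳ v b))))
... | u ∷ʳ′ a  | []       = ⊥-elim (∷ʳ≢[] u (suc a) (trans (sym (incLast-∷ʳ u a)) eq))
... | u ∷ʳ′ a  | v ∷ʳ′ b  with ∷ʳ-injective u v (trans (sym (incLast-∷ʳ u a)) (trans eq (incLast-∷ʳ v b)))
...   | refl , refl = refl

compositions-split : ∀ n k → compositions (suc n) (suc k) ↭ map (_∷ʳ 0) (compositions n (suc k)) ++ map incLast (compositions (suc n) k)
compositions-split n k = unique-↭ (compositions-unique (suc n) (suc k))
  (Unique.++⁺ (Unique.map⁺ (λ {x} {y} → ∷ʳ-injectiveˡ x y) (compositions-unique n (suc k)))
              (Unique.map⁺ incLast-injective (compositions-unique (suc n) k)) disjoint)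
  to from
  where
  disjoint : ∀ {z} → z ∈ map (_∷ʳ 0) (compositions n (suc k)) × z ∈ map incLast (compositions (suc n) k) → ⊥
  disjoint (z∈₁ , z∈₂) with ∈-map⁻ (_∷ʳ 0) z∈₁ | ∈-map⁻ incLast z∈₂
  ... | c , _ , refl | d , _ , eq with initLast d
  ...   | []      = ∷ʳ≢[] c 0 eq
  ...   | v ∷ʳ′ b with () ← ∷ʳ-injectiveʳ c v (trans eq (incLast-∷ʳ v b))
  to : ∀ {z} → z ∈ compositions (suc n) (suc k) → z ∈ map (_∷ʳ 0) (compositions n (suc k)) ++ map incLast (compositions (suc n) k)
  to {z} z∈ with ∈-compositions⁻ z∈ | initLast z
  ... | len , total | [] with () ← len
  ... | len , total | u ∷ʳ′ zero = ∈-++⁺ˡ (∈-map⁺ (_∷ʳ 0) (∈-compositions⁺ n (suc k) u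
        (suc-injective (trans (sym (length-∷ʳ u 0)) len) , trans (sym (+-identityʳ (sum u))) (trans (sym (sum-∷ʳ u 0)) total))))
  ... | len , total | u ∷ʳ′ suc a = ∈-++⁺ʳ _ (subst (_∈ map incLast (compositions (suc n) k)) (incLast-∷ʳ u a)
        (∈-map⁺ incLast (∈-compositions⁺ (suc n) k (u ∷ʳ a)
          (trans (length-∷ʳ u a) (trans (sym (length-∷ʳ u (suc a))) len) ,
           suc-injective (trans (cong suc (sum-∷ʳ u a)) (trans (sym (+-suc (sum u) a)) (trans (sym (sum-∷ʳ u (suc a))) total)))))))
  from : ∀ {z} → z ∈ map (_∷ʳ 0) (compositions n (suc k)) ++ map incLast (compositions (suc n) k) → z ∈ compositions (suc n) (suc k)
  from z∈ with ∈-++⁻ (map (_∷ʳ 0) (compositions n (suc k))) z∈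
  ... | inj₁ z∈₁ with c , c∈ , refl ← ∈-map⁻ (_∷ʳ 0) z∈₁ with len , total ← ∈-compositions⁻ c∈ =
    ∈-compositions⁺ (suc n) (suc k) (c ∷ʳ 0) (trans (length-∷ʳ c 0) (cong suc len) , trans (sum-∷ʳ c 0) (trans (+-identityʳ _) total))
  ... | inj₂ z∈₂ with d , d∈ , refl ← ∈-map⁻ incLast z∈₂ with ∈-compositions⁻ d∈ | initLast d
  ...   | () , _    | []
  ...   | len′ , total′ | v ∷ʳ′ b = subst (_∈ compositions (suc n) (suc k)) (sym (incLast-∷ʳ v b)) (∈-compositions⁺ (suc n) (suc k) (v ∷ʳ suc b)
    (trans (length-∷ʳ v (suc b)) (trans (sym (length-∷ʳ v b)) len′) , trans (sum-∷ʳ v (suc b)) (trans (+-suc (sum v) b) (cong suc (trans (sym (sum-∷ʳ v b)) total′)))))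

onCycle-incLast : ∀ {ℓ} s c → ℓ < length c →
  (onCycleOfLength (rotatePrefix ℓ) s c ≡ true) ⇔ (onCycleOfLength (rotatePrefix ℓ) s (incLast c) ≡ true)
onCycle-incLast s c ℓ< with initLast c
... | v ∷ʳ′ b rewrite incLast-∷ʳ v b = mk⇔
  (Equivalence.from (onCycle-∷ʳ s (suc b) ℓ≤) ∘ Equivalence.to (onCycle-∷ʳ s b ℓ≤))
  (Equivalence.from (onCycle-∷ʳ s b ℓ≤) ∘ Equivalence.to (onCycle-∷ʳ s (suc b) ℓ≤))
  where ℓ≤ = ≤-pred (subst (_ <_) (length-∷ʳ v b) ℓ<)

cyclePoints-suc-suc : ∀ {ℓ n} s k → ℓ ≤ n → cyclePoints ℓ s (suc n) (suc k) ≡ cyclePoints ℓ s n (suc k) + cyclePoints ℓ s (suc n) k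
cyclePoints-suc-suc {ℓ} {n} s k ℓ≤n = begin
  length (filter P? (compositions (suc n) (suc k)))
    ≡⟨ length-filter-↭ P? (compositions-split n k) ⟩
  length (filter P? (map (_∷ʳ 0) (compositions n (suc k)) ++ map incLast (compositions (suc n) k)))
    ≡⟨ length-filter-++ P? (map (_∷ʳ 0) (compositions n (suc k))) _ ⟩
  length (filter P? (map (_∷ʳ 0) (compositions n (suc k)))) + length (filter P? (map incLast (compositions (suc n) k)))
    ≡⟨ sym (cong₂ _+_ (length-filter-map P? P? (_∷ʳ 0) (compositions n (suc k)) append-0)
                      (length-filter-map P? P? incLast (compositions (suc n) k) increment)) ⟩
  length (filter P? (compositions n (suc k))) + length (filter P? (compositions (suc n) k))
    ∎
  where
  open ≡-Reasoning
  P? = onCycle? (rotatePrefix ℓ) s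
  append-0 : ∀ {c} → c ∈ compositions n (suc k) → _ ⇔ _
  append-0 {c} c∈ = let e = onCycle-∷ʳ s 0 (subst (ℓ ≤_) (sym (proj₁ (∈-compositions⁻ {n} {suc k} c∈))) ℓ≤n) in
    mk⇔ (Equivalence.from e) (Equivalence.to e)
  increment : ∀ {c} → c ∈ compositions (suc n) k → _ ⇔ _
  increment {c} c∈ = onCycle-incLast s c (subst (ℓ <_) (sym (proj₁ (∈-compositions⁻ {suc n} {k} c∈))) (s≤s ℓ≤n))

∣cyclePoints : ∀ ℓ n k {s} → 1 ≤ s → s ∣ cyclePoints ℓ s n k
∣cyclePoints ℓ n k {s} 1≤s = minimalPeriod-∣-length (≡-dec _≟_) (rotatePrefix ℓ) L
  (Unique.filter⁺ P? (compositions-unique n k)) closed period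
  where
  P? = onCycle? (rotatePrefix ℓ) s
  L = filter P? (compositions n k)
  period : ∀ {c} → c ∈ L → MinimalPeriod (rotatePrefix ℓ) s c
  period {c} c∈ = Equivalence.to (onCycleOfLength≡true⇔ (rotatePrefix ℓ) c s) (proj₂ (∈-filter⁻ P? {xs = compositions n k} c∈))
  closed : ∀ {c} → c ∈ L → rotatePrefix ℓ c ∈ L
  closed {c} c∈ = ∈-filter⁺ P? (rotatePrefix-compositions ℓ {n} {k} (proj₁ (∈-filter⁻ P? {xs = compositions n k} c∈)))
    (Equivalence.from (onCycleOfLength≡true⇔ (rotatePrefix ℓ) (rotatePrefix ℓ c) s) (minimalPeriod-step (period c∈)))

lastOf-replicate : ∀ m a → lastOf a (replicate m a) ≡ a
lastOf-replicate zero    a = refl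
lastOf-replicate (suc m) a = lastOf-replicate m a

initOf-replicate : ∀ m a → initOf a (replicate m a) ≡ replicate m a
initOf-replicate zero    a = refl
initOf-replicate (suc m) a = cong (a ∷_) (initOf-replicate m a)

rotateRight-replicate : ∀ m a → rotateRight (replicate m a) ≡ replicate m a
rotateRight-replicate zero    a = refl
rotateRight-replicate (suc m) a = cong₂ _∷_ (lastOf-replicate m a) (initOf-replicate m a)

rotatePrefix-replicate : ∀ ℓ n a → rotatePrefix ℓ (replicate n a) ≡ replicate n a
rotatePrefix-replicate ℓ n a = begin
  rotateRight (take ℓ (replicate n a)) ++ drop ℓ (replicate n a) ≡⟨ cong (_++ drop ℓ (replicate n a)) (rotateRight-take) ⟩
  take ℓ (replicate n a) ++ drop ℓ (replicate n a)               ≡⟨ take++drop≡id ℓ (replicate n a) ⟩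
  replicate n a                                                  ∎
  where
  open ≡-Reasoning
  rotateRight-take : rotateRight (take ℓ (replicate n a)) ≡ take ℓ (replicate n a)
  rotateRight-take rewrite take-replicate ℓ n a = rotateRight-replicate (ℓ ⊓ n) a

module _ {ℓ n : ℕ} where
  private
    zeros-fixed : ∀ m → iter (rotatePrefix ℓ) m (replicate n 0) ≡ replicate n 0
    zeros-fixed m = iter-fixed (rotatePrefix ℓ) m (rotatePrefix-replicate ℓ n 0)

  cyclePoints-k≡0-s≡1 : cyclePoints ℓ 1 n 0 ≡ 1
  cyclePoints-k≡0-s≡1 with onCycle? (rotatePrefix ℓ) 1 (replicate n 0)
  ... | yes _  = refl
  ... | no off = ⊥-elim (off (Equivalence.from (onCycleOfLength≡true⇔ (rotatePrefix ℓ) (replicate n 0) 1)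
                   (record { positive = ≤-refl ; periodic = zeros-fixed 1 ; minimal = λ m 1≤m m<1 → ⊥-elim (<-irrefl refl (≤-trans m<1 1≤m)) })))

  cyclePoints-k≡0-s≥2 : ∀ {s} → 2 ≤ s → cyclePoints ℓ s n 0 ≡ 0
  cyclePoints-k≡0-s≥2 {s} 2≤s with onCycle? (rotatePrefix ℓ) s (replicate n 0)
  ... | no _  = refl
  ... | yes on = ⊥-elim (MinimalPeriod.minimal (Equivalence.to (onCycleOfLength≡true⇔ (rotatePrefix ℓ) (replicate n 0) s) on) 1 ≤-refl 2≤s (zeros-fixed 1))

cyclePoints-k≡1-s≡1 : ∀ ℓ r → cyclePoints ℓ 1 (ℓ + r) 1 ≡ cyclePoints ℓ 1 ℓ 1 + r
cyclePoints-k≡1-s≡1 ℓ zero    = trans (cong (λ n → cyclePoints ℓ 1 n 1) (+-identityʳ ℓ)) (sym (+-identityʳ _))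
cyclePoints-k≡1-s≡1 ℓ (suc r) = begin
  cyclePoints ℓ 1 (ℓ + suc r) 1                               ≡⟨ cong (λ n → cyclePoints ℓ 1 n 1) (+-suc ℓ r) ⟩
  cyclePoints ℓ 1 (suc (ℓ + r)) 1                             ≡⟨ cyclePoints-suc-suc 1 0 (m≤m+n ℓ r) ⟩
  cyclePoints ℓ 1 (ℓ + r) 1 + cyclePoints ℓ 1 (suc (ℓ + r)) 0 ≡⟨ cong₂ _+_ (cyclePoints-k≡1-s≡1 ℓ r) (cyclePoints-k≡0-s≡1 {ℓ}) ⟩
  cyclePoints ℓ 1 ℓ 1 + r + 1                                 ≡⟨ +-assoc _ r 1 ⟩
  cyclePoints ℓ 1 ℓ 1 + (r + 1)                               ≡⟨ cong (_+_ (cyclePoints ℓ 1 ℓ 1)) (+-comm r 1) ⟩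
  cyclePoints ℓ 1 ℓ 1 + suc r                                 ∎
  where open ≡-Reasoning

cyclePoints-k≡1-s≥2 : ∀ ℓ r {s} → 2 ≤ s → cyclePoints ℓ s (ℓ + r) 1 ≡ cyclePoints ℓ s ℓ 1
cyclePoints-k≡1-s≥2 ℓ zero    {s} _   = cong (λ n → cyclePoints ℓ s n 1) (+-identityʳ ℓ)
cyclePoints-k≡1-s≥2 ℓ (suc r) {s} 2≤s = begin
  cyclePoints ℓ s (ℓ + suc r) 1                               ≡⟨ cong (λ n → cyclePoints ℓ s n 1) (+-suc ℓ r) ⟩
  cyclePoints ℓ s (suc (ℓ + r)) 1                             ≡⟨ cyclePoints-suc-suc s 0 (m≤m+n ℓ r) ⟩
  cyclePoints ℓ s (ℓ + r) 1 + cyclePoints ℓ s (suc (ℓ + r)) 0 ≡⟨ cong₂ _+_ (cyclePoints-k≡1-s≥2 ℓ r 2≤s) (cyclePoints-k≡0-s≥2 {ℓ} 2≤s) ⟩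
  cyclePoints ℓ s ℓ 1 + 0                                     ≡⟨ +-identityʳ _ ⟩
  cyclePoints ℓ s ℓ 1                                         ∎
  where open ≡-Reasoning

-- The case n = ℓ: rotations of compositions

rotatePrefix-full : ∀ {ℓ} c → length c ≡ ℓ → rotatePrefix ℓ c ≡ rotateRight c
rotatePrefix-full c refl rewrite take-all (length c) c ≤-refl | drop-all (length c) c ≤-refl = ++-identityʳ (rotateRight c)

iter-rotatePrefix-full : ∀ {ℓ} m c → length c ≡ ℓ → iter (rotatePrefix ℓ) m c ≡ iter rotateRight m c
iter-rotatePrefix-full         zero    c _   = refl
iter-rotatePrefix-full {ℓ} (suc m) c len = trans (rotatePrefix-full _ (trans (length-iter-rotatePrefix ℓ m c) len)) (cong rotateRight (iter-rotatePrefix-full m c len))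

iter-rotateRight-fixed⇔ : ∀ m c → (iter rotateRight m c ≡ c) ⇔ (iter rotateLeft m c ≡ c)
iter-rotateRight-fixed⇔ m c = mk⇔
  (λ fixed → trans (cong (iter rotateLeft m) (sym fixed)) (iter-inverse rotateLeft-rotateRight m c))
  (λ fixed → trans (cong (iter rotateRight m) (sym fixed)) (iter-inverse rotateRight-rotateLeft m c))

rotationCyclePoints : ℕ → ℕ → ℕ → ℕ
rotationCyclePoints ℓ s k = length (filter (onCycle? rotateLeft s) (compositions ℓ k))

cyclePoints-n≡ℓ : ∀ ℓ s k → cyclePoints ℓ s ℓ k ≡ rotationCyclePoints ℓ s k
cyclePoints-n≡ℓ ℓ s k = length-filter-cong (onCycle? (rotatePrefix ℓ) s) (onCycle? rotateLeft s) (compositions ℓ k) λ {c} c∈ →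
  onCycleOfLength-cong (λ m → subst (λ d → (d ≡ c) ⇔ _) (sym (iter-rotatePrefix-full m c (proj₁ (∈-compositions⁻ {ℓ} {k} c∈)))) (iter-rotateRight-fixed⇔ m c)) s

drop-take-suc : ∀ t (c : List ℕ) → suc t ≤ length c → Σ ℕ λ y → drop t c ≡ y ∷ drop (suc t) c × take (suc t) c ≡ take t c ∷ʳ y
drop-take-suc zero    (x ∷ c) _         = x , refl , refl
drop-take-suc (suc t) (x ∷ c) (s≤s t<) with y , drop≡ , take≡ ← drop-take-suc t c t< = y , drop≡ , cong (x ∷_) take≡

iter-rotateLeft : ∀ t c → t ≤ length c → iter rotateLeft t c ≡ drop t c ++ take t c
iter-rotateLeft zero    c _   = sym (++-identityʳ c)
iter-rotateLeft (suc t) c t<len with y , drop≡ , take≡ ← drop-take-suc t c t<len = begin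
  rotateLeft (iter rotateLeft t c)            ≡⟨ cong rotateLeft (iter-rotateLeft t c (≤-trans (n≤1+n t) t<len)) ⟩
  rotateLeft (drop t c ++ take t c)           ≡⟨ cong (λ d → rotateLeft (d ++ take t c)) drop≡ ⟩
  (drop (suc t) c ++ take t c) ∷ʳ y           ≡⟨ ++-assoc (drop (suc t) c) (take t c) _ ⟩
  drop (suc t) c ++ (take t c ∷ʳ y)           ≡⟨ cong (drop (suc t) c ++_) (sym take≡) ⟩
  drop (suc t) c ++ take (suc t) c            ∎
  where open ≡-Reasoning

iter-rotateLeft-length : ∀ c → iter rotateLeft (length c) c ≡ c
iter-rotateLeft-length c = trans (iter-rotateLeft (length c) c ≤-refl)
  (trans (cong (_++ take (length c) c) (drop-all (length c) c ≤-refl)) (take-all (length c) c ≤-refl))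

repeat : ℕ → List ℕ → List ℕ
repeat d b = concat (replicate d b)

length-repeat : ∀ d b → length (repeat d b) ≡ d * length b
length-repeat zero    b = refl
length-repeat (suc d) b = trans (length-++ b) (cong (_+_ (length b)) (length-repeat d b))

sum-repeat : ∀ d b → sum (repeat d b) ≡ d * sum b
sum-repeat zero    b = refl
sum-repeat (suc d) b = trans (sum-++ b (repeat d b)) (cong (_+_ (sum b)) (sum-repeat d b))

repeat-++-comm : ∀ d b → repeat d b ++ b ≡ b ++ repeat d b
repeat-++-comm zero    b = sym (++-identityʳ b)
repeat-++-comm (suc d) b = trans (++-assoc b (repeat d b) b) (cong (b ++_) (repeat-++-comm d b))

++-comm⇒repeat : ∀ d (b r : List ℕ) → length r ≡ d * length b → r ++ b ≡ b ++ r → r ≡ repeat d b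
++-comm⇒repeat zero    b []  _   _    = refl
++-comm⇒repeat (suc d) b r len comm = begin
  r                                      ≡⟨ sym (take++drop≡id (length b) r) ⟩
  take (length b) r ++ drop (length b) r ≡⟨ cong₂ _++_ head≡b (++-comm⇒repeat d b (drop (length b) r) length-rest rest-comm) ⟩
  b ++ repeat d b                        ∎
  where
  open ≡-Reasoning
  b≤r : length b ≤ length r
  b≤r = subst (length b ≤_) (sym len) (m≤m+n (length b) _)
  head≡b : take (length b) r ≡ b
  head≡b = trans (sym (take-++-≤ (length b) r b b≤r)) (trans (cong (take (length b)) comm) (take-length-++ b r))
  length-rest : length (drop (length b) r) ≡ d * length b
  length-rest = trans (length-drop (length b) r) (trans (cong (_∸ length b) len) (m+n∸m≡n (length b) _))
  rest-comm : drop (length b) r ++ b ≡ b ++ drop (length b) r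
  rest-comm = begin
    drop (length b) r ++ b                 ≡⟨ sym (drop-++-≤ (length b) r b b≤r) ⟩
    drop (length b) (r ++ b)               ≡⟨ cong (drop (length b)) comm ⟩
    drop (length b) (b ++ r)               ≡⟨ drop-length-++ b r ⟩
    r                                      ≡⟨ sym (take++drop≡id (length b) r) ⟩
    take (length b) r ++ drop (length b) r ≡⟨ cong (_++ drop (length b) r) head≡b ⟩
    b ++ drop (length b) r                 ∎

module _ (t d′ : ℕ) where
  private
    d = suc d′

  fixed⇒repeat : ∀ c → length c ≡ d * t → iter rotateLeft t c ≡ c → c ≡ repeat d (take t c)
  fixed⇒repeat c len fixed = begin
    c                       ≡⟨ sym (take++drop≡id t c) ⟩
    take t c ++ drop t c    ≡⟨ cong (take t c ++_) (++-comm⇒repeat d′ (take t c) (drop t c) length-rest rest-comm) ⟩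
    take t c ++ repeat d′ (take t c) ∎
    where
    open ≡-Reasoning
    t≤c : t ≤ length c
    t≤c = subst (t ≤_) (sym len) (m≤m+n t _)
    length-rest : length (drop t c) ≡ d′ * length (take t c)
    length-rest = trans (length-drop t c) (trans (cong (_∸ t) len) (trans (m+n∸m≡n t _) (cong (d′ *_) (sym (trans (length-take t c) (m≤n⇒m⊓n≡m t≤c))))))
    rest-comm : drop t c ++ take t c ≡ take t c ++ drop t c
    rest-comm = trans (sym (iter-rotateLeft t c t≤c)) (trans fixed (sym (take++drop≡id t c)))

  repeat-fixed : ∀ b → length b ≡ t → iter rotateLeft t (repeat d b) ≡ repeat d b
  repeat-fixed b refl = begin
    iter rotateLeft (length b) (b ++ repeat d′ b)                      ≡⟨ iter-rotateLeft (length b) (b ++ repeat d′ b) b≤ ⟩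
    drop (length b) (b ++ repeat d′ b) ++ take (length b) (b ++ repeat d′ b) ≡⟨ cong₂ _++_ (drop-length-++ b (repeat d′ b)) (take-length-++ b (repeat d′ b)) ⟩
    repeat d′ b ++ b                                                   ≡⟨ repeat-++-comm d′ b ⟩
    b ++ repeat d′ b                                                   ∎
    where
    open ≡-Reasoning
    b≤ : length b ≤ length (b ++ repeat d′ b)
    b≤ = subst (length b ≤_) (sym (length-++ b)) (m≤m+n _ _)

  repeat-injective : ∀ {b b′} → repeat d b ≡ repeat d b′ → b ≡ b′
  repeat-injective {b} {b′} eq = begin
    b                                        ≡⟨ sym (take-length-++ b (repeat d′ b)) ⟩
    take (length b) (repeat d b)             ≡⟨ cong₂ take same-length eq ⟩
    take (length b′) (repeat d b′)           ≡⟨ take-length-++ b′ _ ⟩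
    b′                                       ∎
    where
    open ≡-Reasoning
    same-length : length b ≡ length b′
    same-length = *-cancelˡ-≡ (length b) (length b′) d (trans (sym (length-repeat d b)) (trans (cong length eq) (length-repeat d b′)))

rotationFixedPoints : ℕ → ℕ → ℕ → ℕ
rotationFixedPoints ℓ t k = length (filter (fixed? rotateLeft t) (compositions ℓ k))

module _ (t d′ : ℕ) where
  private
    d = suc d′

  rotationFixedPoints-repeat : ∀ k′ → rotationFixedPoints (d * t) t (d * k′) ≡ length (compositions t k′)
  rotationFixedPoints-repeat k′ = trans (↭-length fixed↭repeats) (length-map (repeat d) (compositions t k′))
    where
    fixed↭repeats : filter (fixed? rotateLeft t) (compositions (d * t) (d * k′)) ↭ map (repeat d) (compositions t k′)
    fixed↭repeats = unique-↭ (Unique.filter⁺ (fixed? rotateLeft t) (compositions-unique (d * t) (d * k′)))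
      (Unique.map⁺ (repeat-injective t d′) (compositions-unique t k′)) to from
      where
      to : ∀ {z} → z ∈ filter (fixed? rotateLeft t) (compositions (d * t) (d * k′)) → z ∈ map (repeat d) (compositions t k′)
      to {z} z∈ with z∈′ , fixed ← ∈-filter⁻ (fixed? rotateLeft t) {xs = compositions (d * t) (d * k′)} z∈
                with len , total ← ∈-compositions⁻ {d * t} {d * k′} z∈′ =
        subst (_∈ map (repeat d) (compositions t k′)) (sym z≡) (∈-map⁺ (repeat d) (∈-compositions⁺ t k′ (take t z) (length-head , sum-head)))
        where
        z≡ = fixed⇒repeat t d′ z len fixed
        t≤z : t ≤ length z
        t≤z = subst (t ≤_) (sym len) (m≤m+n t _)
        length-head : length (take t z) ≡ t
        length-head = trans (length-take t z) (m≤n⇒m⊓n≡m t≤z)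
        sum-head : sum (take t z) ≡ k′
        sum-head = *-cancelˡ-≡ _ _ d (trans (sym (sum-repeat d (take t z))) (trans (cong sum (sym z≡)) total))
      from : ∀ {z} → z ∈ map (repeat d) (compositions t k′) → z ∈ filter (fixed? rotateLeft t) (compositions (d * t) (d * k′))
      from z∈ with b , b∈ , refl ← ∈-map⁻ (repeat d) z∈ with len , total ← ∈-compositions⁻ {t} {k′} b∈ =
        ∈-filter⁺ (fixed? rotateLeft t)
          (∈-compositions⁺ (d * t) (d * k′) (repeat d b) (trans (length-repeat d b) (cong (d *_) len) , trans (sum-repeat d b) (cong (d *_) total)))
          (repeat-fixed t d′ b len)

  rotationFixedPoints-∤ : ∀ k → ¬ d ∣ k → rotationFixedPoints (d * t) t k ≡ 0
  rotationFixedPoints-∤ k d∤k = length-filter-none (fixed? rotateLeft t) (compositions (d * t) k) λ {z} z∈ fixed →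
    let len , total = ∈-compositions⁻ {d * t} {k} z∈ in
    d∤k (divides (sum (take t z)) (trans (sym total) (trans (cong sum (fixed⇒repeat t d′ z len fixed)) (trans (sum-repeat d (take t z)) (*-comm d _)))))

onCycle-rotateLeft⇒∣ : ∀ {ℓ s k c} → 1 ≤ ℓ → c ∈ compositions ℓ k → onCycleOfLength rotateLeft s c ≡ true → s ∣ ℓ × (ℓ div s) ∣ k
onCycle-rotateLeft⇒∣ {ℓ} {s} {k} {c} 1≤ℓ c∈ on with len , total ← ∈-compositions⁻ {ℓ} {k} c∈ = s∣ℓ , ℓ/s∣k
  where
  per = Equivalence.to (onCycleOfLength≡true⇔ rotateLeft c s) on
  s∣ℓ : s ∣ ℓ
  s∣ℓ = minimalPeriod-∣ per (subst (λ t → iter rotateLeft t c ≡ c) len (iter-rotateLeft-length c))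
  ℓ/s∣k : (ℓ div s) ∣ k
  ℓ/s∣k with s∣ℓ
  ... | divides zero    ℓ≡0 = ⊥-elim (<-irrefl (sym ℓ≡0) 1≤ℓ)
  ... | divides (suc q) ℓ≡ = subst (_∣ k) (sym (trans (cong (_div s) ℓ≡) (div-cancelʳ (suc q) (MinimalPeriod.positive per))))
    (divides (sum (take s c)) (trans (sym total) (trans (cong sum (fixed⇒repeat s q c (trans len ℓ≡) (MinimalPeriod.periodic per)))
      (trans (sum-repeat (suc q) (take s c)) (*-comm (suc q) _)))))

rotationCyclePoints-∤ : ∀ {ℓ s k} → 1 ≤ ℓ → ¬ (s ∣ ℓ × (ℓ div s) ∣ k) → rotationCyclePoints ℓ s k ≡ 0
rotationCyclePoints-∤ {ℓ} {s} {k} 1≤ℓ ∤ = length-filter-none (onCycle? rotateLeft s) (compositions ℓ k) (λ c∈ on → ∤ (onCycle-rotateLeft⇒∣ 1≤ℓ c∈ on))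

∣×div∣1⇒≡ : ∀ {u ℓ} → u ∣ ℓ → (ℓ div u) ∣ 1 → u ≡ ℓ
∣×div∣1⇒≡ {zero}   (divides q ℓ≡) _     = sym (trans ℓ≡ (*-zeroʳ q))
∣×div∣1⇒≡ {suc u′} (divides q ℓ≡) ℓ/u∣1 = sym (trans ℓ≡ (trans (cong (_* suc u′) q≡1) (*-identityˡ (suc u′))))
  where
  q≡1 : q ≡ 1
  q≡1 = trans (sym (trans (cong (_/ suc u′) ℓ≡) (m*n/n≡m q (suc u′)))) (∣1⇒≡1 ℓ/u∣1)

rotationCyclePoints-s≡ℓ-k≡1 : ∀ {ℓ} → 1 ≤ ℓ → rotationCyclePoints ℓ ℓ 1 ≡ ℓ
rotationCyclePoints-s≡ℓ-k≡1 {ℓ} 1≤ℓ = begin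
  rotationCyclePoints ℓ ℓ 1
    ≡⟨ sym (sum-map-single (λ u → rotationCyclePoints ℓ u 1) (divisors-unique ℓ) (∈-divisors⁺ 1≤ℓ ∣-refl) other-divisors) ⟩
  sum (map (λ u → rotationCyclePoints ℓ u 1) (divisors ℓ))
    ≡⟨ sym (fixedCount≡sum-divisors rotateLeft 1≤ℓ (compositions ℓ 1)) ⟩
  rotationFixedPoints ℓ ℓ 1
    ≡⟨ length-filter-all (fixed? rotateLeft ℓ) (compositions ℓ 1) (λ {c} c∈ → subst (λ t → iter rotateLeft t c ≡ c) (proj₁ (∈-compositions⁻ {ℓ} {1} c∈)) (iter-rotateLeft-length c)) ⟩
  length (compositions ℓ 1)
    ≡⟨ length-compositions-1 ℓ ⟩
  ℓ ∎
  where
  open ≡-Reasoning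
  other-divisors : ∀ {u} → u ∈ divisors ℓ → u ≢ ℓ → rotationCyclePoints ℓ u 1 ≡ 0
  other-divisors _ u≢ℓ = rotationCyclePoints-∤ 1≤ℓ (λ (u∣ℓ , ℓ/u∣1) → u≢ℓ (∣×div∣1⇒≡ u∣ℓ ℓ/u∣1))

absorption : ∀ n k → suc k * (suc n C suc k) ≡ suc n * (n C k)
absorption zero    zero    = refl
absorption zero    (suc k) = *-zeroʳ (suc (suc k))
absorption (suc n) zero    = trans (+-identityʳ _) (trans (nC1≡n (suc (suc n))) (sym (*-identityʳ (suc (suc n)))))
absorption (suc n) (suc k) = begin
  suc (suc k) * (suc (suc n) C suc (suc k))        ≡⟨ cong (suc (suc k) *_) (sym (nCk+nC[k+1]≡[n+1]C[k+1] (suc n) (suc k))) ⟩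
  suc (suc k) * (X + suc n C suc (suc k))          ≡⟨ *-distribˡ-+ (suc (suc k)) X _ ⟩
  suc (suc k) * X + suc (suc k) * (suc n C suc (suc k)) ≡⟨ cong (_+_ (suc (suc k) * X)) (absorption n (suc k)) ⟩
  X + suc k * X + suc n * Y                        ≡⟨ +-assoc X (suc k * X) _ ⟩
  X + (suc k * X + suc n * Y)                      ≡⟨ cong (λ z → X + (z + suc n * Y)) (absorption n k) ⟩
  X + (suc n * Z + suc n * Y)                      ≡⟨ cong (_+_ X) (sym (*-distribˡ-+ (suc n) Z Y)) ⟩
  X + suc n * (Z + Y)                              ≡⟨ cong (λ z → X + suc n * z) (nCk+nC[k+1]≡[n+1]C[k+1] n k) ⟩
  suc (suc n) * X                                  ∎
  where
  open ≡-Reasoning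
  X = suc n C suc k
  Y = n C suc k
  Z = n C k

+-sum-divisors : ∀ t c → + sum (map c (divisors t)) ≡ sumDivisors t (λ u → + c u)
+-sum-divisors t c = begin
  + sum (map c (divisors t))                                   ≡⟨ +-sum-map c (divisors t) ⟩
  Σℤ (divisors t) (λ u → + c u)                                ≡⟨ sym (Σℤ-if (_∣? t) (λ u → + c u) (upFrom 1 t)) ⟩
  Σℤ (upFrom 1 t) (λ u → if ⌊ u ∣? t ⌋ then + c u else + 0)    ≡⟨ sym (sumDivisors≡Σℤ t (λ u → + c u)) ⟩
  sumDivisors t (λ u → + c u)                                  ∎
  where open ≡-Reasoning

sumDivisors-rotationCyclePoints : ∀ ℓ k {t} → 1 ≤ t → sumDivisors t (λ u → + rotationCyclePoints ℓ u k) ≡ + rotationFixedPoints ℓ t k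
sumDivisors-rotationCyclePoints ℓ k {t} 1≤t =
  trans (sym (+-sum-divisors t (λ u → rotationCyclePoints ℓ u k))) (cong +_ (sym (fixedCount≡sum-divisors rotateLeft 1≤t (compositions ℓ k))))

module _ {s q j : ℕ} (1≤s : 1 ≤ s) (1≤q : 1 ≤ q) where
  private
    ℓ = q * s
    k = j * q
    g = gcd s j

    binomial : ℕ → ℕ
    binomial e = ((s + j) div e) C (s div e)

  rotationFixedPoints-binomial : ∀ {e} → 1 ≤ e → e ∣ s → e ∣ j → (s + j) * rotationFixedPoints ℓ (s div e) k ≡ s * binomial e
  rotationFixedPoints-binomial {e} 1≤e e∣s (divides j′ j≡) with s div e in s/e | div-positive 1≤e 1≤s e∣s
  ... | suc t′ | _ with q * e in qe | *-mono-≤ 1≤q 1≤e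
  ...   | suc d′ | _ = begin
    (s + j) * rotationFixedPoints ℓ t k               ≡⟨ cong₂ (λ a b → (s + j) * rotationFixedPoints a t b) ℓ≡ k≡ ⟩
    (s + j) * rotationFixedPoints (d * t) t (d * j′)  ≡⟨ cong ((s + j) *_) (rotationFixedPoints-repeat t d′ j′) ⟩
    (s + j) * length (compositions t j′)              ≡⟨ cong ((s + j) *_) (length-compositions t′ j′) ⟩
    (s + j) * ((t′ + j′) C t′)                        ≡⟨ cong (_* ((t′ + j′) C t′)) s+j≡ ⟩
    e * (t + j′) * ((t′ + j′) C t′)                   ≡⟨ *-assoc e (t + j′) _ ⟩
    e * (suc (t′ + j′) * ((t′ + j′) C t′))            ≡⟨ cong (e *_) (sym (absorption (t′ + j′) t′)) ⟩
    e * (t * ((t + j′) C t))                          ≡⟨ sym (*-assoc e t _) ⟩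
    e * t * ((t + j′) C t)                            ≡⟨ cong (_* ((t + j′) C t)) et≡s ⟩
    s * ((t + j′) C t)                                ≡⟨ cong (λ z → s * (z C t)) (sym (trans (cong (_div e) s+j≡) (trans (cong (_div e) (*-comm e (t + j′))) (div-cancelʳ (t + j′) 1≤e)))) ⟩
    s * (((s + j) div e) C t)                         ∎
    where
    open ≡-Reasoning
    t = suc t′
    d = suc d′
    et≡s : e * t ≡ s
    et≡s = trans (cong (e *_) (sym s/e)) (div-cancelˡ 1≤e e∣s)
    ℓ≡ : ℓ ≡ d * t
    ℓ≡ = trans (cong (q *_) (sym et≡s)) (trans (sym (*-assoc q e t)) (cong (_* t) qe))
    k≡ : k ≡ d * j′
    k≡ = trans (cong (_* q) j≡) (trans (rearrange j′ e q) (cong (_* j′) qe))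
      where
      rearrange : ∀ a b c → a * b * c ≡ c * b * a
      rearrange = solve-∀
    s+j≡ : s + j ≡ e * (t + j′)
    s+j≡ = trans (cong₂ _+_ (sym et≡s) (trans j≡ (*-comm j′ e))) (sym (*-distribˡ-+ e t j′))

  rotationFixedPoints-vanish : ∀ {e} → 1 ≤ e → e ∣ s → ¬ e ∣ j → rotationFixedPoints ℓ (s div e) k ≡ 0
  rotationFixedPoints-vanish {e} 1≤e e∣s e∤j with q * e in qe | *-mono-≤ 1≤q 1≤e
  ... | suc d′ | _ = trans (cong (λ a → rotationFixedPoints a (s div e) k) ℓ≡) (rotationFixedPoints-∤ (s div e) d′ k d∤k)
    where
    ℓ≡ : ℓ ≡ suc d′ * (s div e)
    ℓ≡ = trans (cong (q *_) (sym (div-cancelˡ 1≤e e∣s))) (trans (sym (*-assoc q e (s div e))) (cong (_* (s div e)) qe))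
    d∤k : ¬ suc d′ ∣ k
    d∤k d∣k = e∤j (*-cancelˡ-∣ q {{>-nonZero 1≤q}} (subst (_∣ q * j) (sym qe) (subst (suc d′ ∣_) (*-comm j q) d∣k)))

  private
    N : ℕ → ℤ
    N u = + rotationCyclePoints ℓ u k

    term : ℕ → ℤ
    term e = if ⌊ e ∣? g ⌋ then μ e *ℤ + binomial e else + 0

    weighted-term : ∀ {e} → 1 ≤ e → + (s + j) *ℤ (if ⌊ e ∣? s ⌋ then μ e *ℤ sumDivisors (s div e) N else + 0) ≡ + s *ℤ term e
    weighted-term {e} 1≤e with e ∣? s | e ∣? j | e ∣? g
    ... | no e∤s  | _       | yes e∣g = ⊥-elim (e∤s (∣-trans e∣g (gcd[m,n]∣m s j)))
    ... | no _    | _       | no _    = trans (ℤ.*-zeroʳ (+ (s + j))) (sym (ℤ.*-zeroʳ (+ s)))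
    ... | yes e∣s | yes e∣j | no e∤g  = ⊥-elim (e∤g (gcd-greatest e∣s e∣j))
    ... | yes _   | no e∤j  | yes e∣g = ⊥-elim (e∤j (∣-trans e∣g (gcd[m,n]∣n s j)))
    ... | yes e∣s | no e∤j  | no _    = begin
      + (s + j) *ℤ (μ e *ℤ sumDivisors (s div e) N)                ≡⟨ cong (λ z → + (s + j) *ℤ (μ e *ℤ z)) fixed-points ⟩
      + (s + j) *ℤ (μ e *ℤ + 0)                                    ≡⟨ cong (+ (s + j) *ℤ_) (ℤ.*-zeroʳ (μ e)) ⟩
      + (s + j) *ℤ + 0                                             ≡⟨ ℤ.*-zeroʳ (+ (s + j)) ⟩
      + 0                                                          ≡⟨ sym (ℤ.*-zeroʳ (+ s)) ⟩
      + s *ℤ + 0                                                   ∎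
      where
      open ≡-Reasoning
      fixed-points : sumDivisors (s div e) N ≡ + 0
      fixed-points = trans (sumDivisors-rotationCyclePoints ℓ k (div-positive 1≤e 1≤s e∣s)) (cong +_ (rotationFixedPoints-vanish 1≤e e∣s e∤j))
    ... | yes e∣s | yes e∣j | yes _   = begin
      + (s + j) *ℤ (μ e *ℤ sumDivisors (s div e) N)                ≡⟨ cong (λ z → + (s + j) *ℤ (μ e *ℤ z)) (sumDivisors-rotationCyclePoints ℓ k (div-positive 1≤e 1≤s e∣s)) ⟩
      + (s + j) *ℤ (μ e *ℤ + rotationFixedPoints ℓ (s div e) k)    ≡⟨ *ℤ-left-comm (+ (s + j)) (μ e) _ ⟩
      μ e *ℤ (+ (s + j) *ℤ + rotationFixedPoints ℓ (s div e) k)    ≡⟨ cong (μ e *ℤ_) (sym (ℤ.pos-* (s + j) _)) ⟩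
      μ e *ℤ + ((s + j) * rotationFixedPoints ℓ (s div e) k)       ≡⟨ cong (λ z → μ e *ℤ + z) (rotationFixedPoints-binomial 1≤e e∣s e∣j) ⟩
      μ e *ℤ + (s * binomial e)                                    ≡⟨ cong (μ e *ℤ_) (ℤ.pos-* s (binomial e)) ⟩
      μ e *ℤ (+ s *ℤ + binomial e)                                 ≡⟨ *ℤ-left-comm (μ e) (+ s) (+ binomial e) ⟩
      + s *ℤ (μ e *ℤ + binomial e)                                 ∎
      where open ≡-Reasoning

    mobiusSum≡ : mobiusSum ℓ s k ≡ sumDivisors g (λ e → μ e *ℤ + binomial e)
    mobiusSum≡ = cong (λ x → sumDivisors (gcd s x) (λ e → μ e *ℤ + (((s + x) div e) C (s div e)))) sk/ℓ≡j
      where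
      sk/ℓ≡j : (s * k) div ℓ ≡ j
      sk/ℓ≡j = trans (cong (_div ℓ) (rearrange s j q)) (div-cancelʳ j (*-mono-≤ 1≤q 1≤s))
        where
        rearrange : ∀ a b c → a * (b * c) ≡ b * (c * a)
        rearrange = solve-∀

    1≤g : 1 ≤ g
    1≤g = n≢0⇒n>0 (gcd[m,n]≢0 s j (inj₁ (λ s≡0 → <-irrefl (sym s≡0) 1≤s)))

  rotationCyclePoints-formula : + (s + j) *ℤ + rotationCyclePoints ℓ s k ≡ + s *ℤ mobiusSum ℓ s k
  rotationCyclePoints-formula = begin
    + (s + j) *ℤ N s
      ≡⟨ cong (+ (s + j) *ℤ_) (sym (möbius-inversion N 1≤s)) ⟩
    + (s + j) *ℤ sumDivisors s (λ e → μ e *ℤ sumDivisors (s div e) N)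
      ≡⟨ cong (+ (s + j) *ℤ_) (sumDivisors≡Σℤ s _) ⟩
    + (s + j) *ℤ Σℤ (upFrom 1 s) (λ e → if ⌊ e ∣? s ⌋ then μ e *ℤ sumDivisors (s div e) N else + 0)
      ≡⟨ sym (Σℤ-*ˡ (+ (s + j)) _ (upFrom 1 s)) ⟩
    Σℤ (upFrom 1 s) (λ e → + (s + j) *ℤ (if ⌊ e ∣? s ⌋ then μ e *ℤ sumDivisors (s div e) N else + 0))
      ≡⟨ Σℤ-cong (upFrom 1 s) (λ e∈ → weighted-term (proj₁ (∈-upFrom⁻ e∈))) ⟩
    Σℤ (upFrom 1 s) (λ e → + s *ℤ term e)
      ≡⟨ Σℤ-*ˡ (+ s) term (upFrom 1 s) ⟩
    + s *ℤ Σℤ (upFrom 1 s) term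
      ≡⟨ cong (+ s *ℤ_) (Σℤ-upFrom-truncate term (∣⇒≤′ 1≤s (gcd[m,n]∣m s j)) beyond-g) ⟩
    + s *ℤ Σℤ (upFrom 1 g) term
      ≡⟨ cong (+ s *ℤ_) (sym (trans (mobiusSum≡) (sumDivisors≡Σℤ g _))) ⟩
    + s *ℤ mobiusSum ℓ s k
      ∎
    where
    open ≡-Reasoning
    beyond-g : ∀ e → g < e → term e ≡ + 0
    beyond-g e g<e with e ∣? g
    ... | no _    = refl
    ... | yes e∣g = ⊥-elim (<-irrefl refl (<-≤-trans g<e (∣⇒≤′ 1≤g e∣g)))

Cls-recursion : ∀ {ℓ s n k} → 1 ≤ ℓ → 1 ≤ s → 1 ≤ k → ℓ < n → Cls ℓ s n k ≡ Cls ℓ s (n ∸ 1) k + Cls ℓ s n (k ∸ 1)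
Cls-recursion {ℓ} {s} {suc n} {suc k} 1≤ℓ 1≤s _ (s≤s ℓ≤n) = begin
  Cls ℓ s (suc n) (suc k)                                     ≡⟨ Cls≡cyclePoints-div s (suc k) 1≤ℓ (m≤n⇒m≤1+n ℓ≤n) ⟩
  cyclePoints ℓ s (suc n) (suc k) div s                       ≡⟨ cong (_div s) (cyclePoints-suc-suc s k ℓ≤n) ⟩
  (cyclePoints ℓ s n (suc k) + cyclePoints ℓ s (suc n) k) div s ≡⟨ div-+ˡ _ 1≤s (∣cyclePoints ℓ n (suc k) 1≤s) ⟩
  cyclePoints ℓ s n (suc k) div s + cyclePoints ℓ s (suc n) k div s
    ≡⟨ sym (cong₂ _+_ (Cls≡cyclePoints-div s (suc k) 1≤ℓ ℓ≤n) (Cls≡cyclePoints-div s k 1≤ℓ (m≤n⇒m≤1+n ℓ≤n))) ⟩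
  Cls ℓ s n (suc k) + Cls ℓ s (suc n) k                       ∎
  where open ≡-Reasoning

Cls-ℓ-cycle-k≡1 : ∀ {ℓ n} → 2 ≤ ℓ → ℓ ≤ n → Cls ℓ ℓ n 1 ≡ 1
Cls-ℓ-cycle-k≡1 {ℓ} {n} 2≤ℓ ℓ≤n = begin
  Cls ℓ ℓ n 1                     ≡⟨ Cls≡cyclePoints-div ℓ 1 1≤ℓ ℓ≤n ⟩
  cyclePoints ℓ ℓ n 1 div ℓ       ≡⟨ cong (λ m → cyclePoints ℓ ℓ m 1 div ℓ) (sym (m+[n∸m]≡n ℓ≤n)) ⟩
  cyclePoints ℓ ℓ (ℓ + (n ∸ ℓ)) 1 div ℓ ≡⟨ cong (_div ℓ) (trans (cyclePoints-k≡1-s≥2 ℓ (n ∸ ℓ) 2≤ℓ) (cyclePoints-n≡ℓ ℓ ℓ 1)) ⟩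
  rotationCyclePoints ℓ ℓ 1 div ℓ ≡⟨ cong (_div ℓ) (rotationCyclePoints-s≡ℓ-k≡1 1≤ℓ) ⟩
  ℓ div ℓ                         ≡⟨ div-self 1≤ℓ ⟩
  1                               ∎
  where
  open ≡-Reasoning
  1≤ℓ = ≤-trans (s≤s z≤n) 2≤ℓ

Cls-fixedPoints-k≡1 : ∀ {ℓ n} → 2 ≤ ℓ → ℓ ≤ n → Cls ℓ 1 n 1 ≡ n ∸ ℓ
Cls-fixedPoints-k≡1 {ℓ} {n} 2≤ℓ ℓ≤n = begin
  Cls ℓ 1 n 1                     ≡⟨ Cls≡cyclePoints-div 1 1 1≤ℓ ℓ≤n ⟩
  cyclePoints ℓ 1 n 1 div 1       ≡⟨ n/1≡n _ ⟩
  cyclePoints ℓ 1 n 1             ≡⟨ cong (λ m → cyclePoints ℓ 1 m 1) (sym (m+[n∸m]≡n ℓ≤n)) ⟩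
  cyclePoints ℓ 1 (ℓ + (n ∸ ℓ)) 1 ≡⟨ cyclePoints-k≡1-s≡1 ℓ (n ∸ ℓ) ⟩
  cyclePoints ℓ 1 ℓ 1 + (n ∸ ℓ)   ≡⟨ cong (_+ (n ∸ ℓ)) (trans (cyclePoints-n≡ℓ ℓ 1 1) (rotationCyclePoints-∤ 1≤ℓ no-fixed-rotation)) ⟩
  n ∸ ℓ                           ∎
  where
  open ≡-Reasoning
  1≤ℓ = ≤-trans (s≤s z≤n) 2≤ℓ
  no-fixed-rotation : ¬ (1 ∣ ℓ × (ℓ div 1) ∣ 1)
  no-fixed-rotation (_ , ℓ∣1) = <-irrefl (sym (trans (sym (n/1≡n ℓ)) (∣1⇒≡1 ℓ∣1))) 2≤ℓ

Cls-k≡1-vanishes : ∀ {ℓ s n} → 1 ≤ ℓ → ℓ ≤ n → 2 ≤ s → s ≢ ℓ → Cls ℓ s n 1 ≡ 0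
Cls-k≡1-vanishes {ℓ} {s} {n} 1≤ℓ ℓ≤n 2≤s s≢ℓ = begin
  Cls ℓ s n 1                     ≡⟨ Cls≡cyclePoints-div s 1 1≤ℓ ℓ≤n ⟩
  cyclePoints ℓ s n 1 div s       ≡⟨ cong (λ m → cyclePoints ℓ s m 1 div s) (sym (m+[n∸m]≡n ℓ≤n)) ⟩
  cyclePoints ℓ s (ℓ + (n ∸ ℓ)) 1 div s ≡⟨ cong (_div s) (trans (cyclePoints-k≡1-s≥2 ℓ (n ∸ ℓ) 2≤s) (cyclePoints-n≡ℓ ℓ s 1)) ⟩
  rotationCyclePoints ℓ s 1 div s ≡⟨ cong (_div s) (rotationCyclePoints-∤ 1≤ℓ (λ (s∣ℓ , ℓ/s∣1) → s≢ℓ (∣×div∣1⇒≡ s∣ℓ ℓ/s∣1))) ⟩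
  0 div s                         ≡⟨ 0-div s ⟩
  0                               ∎
  where open ≡-Reasoning

Cls-n≡ℓ-vanishes : ∀ {ℓ s k} → 1 ≤ ℓ → ¬ (s ∣ ℓ × (ℓ div s) ∣ k) → Cls ℓ s ℓ k ≡ 0
Cls-n≡ℓ-vanishes {ℓ} {s} {k} 1≤ℓ ∤ = begin
  Cls ℓ s ℓ k                     ≡⟨ Cls≡cyclePoints-div s k 1≤ℓ ≤-refl ⟩
  cyclePoints ℓ s ℓ k div s       ≡⟨ cong (_div s) (trans (cyclePoints-n≡ℓ ℓ s k) (rotationCyclePoints-∤ 1≤ℓ ∤)) ⟩
  0 div s                         ≡⟨ 0-div s ⟩
  0                               ∎
  where open ≡-Reasoning

Cls-n≡ℓ-formula : ∀ {ℓ s k} → 1 ≤ s → 1 ≤ ℓ → s ∣ ℓ → (ℓ div s) ∣ k → + (s * ℓ + s * k) *ℤ + Cls ℓ s ℓ k ≡ + ℓ *ℤ mobiusSum ℓ s k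
Cls-n≡ℓ-formula {ℓ} {s} {k} 1≤s 1≤ℓ (divides q refl) ℓ/s∣k with divides j refl ← subst (_∣ k) (div-cancelʳ q 1≤s) ℓ/s∣k = begin
  + (s * (q * s) + s * (j * q)) *ℤ + c       ≡⟨ sym (ℤ.pos-* (s * (q * s) + s * (j * q)) c) ⟩
  + ((s * (q * s) + s * (j * q)) * c)        ≡⟨ cong +_ (rearrange s q j c) ⟩
  + (q * ((s + j) * (c * s)))                ≡⟨ trans (ℤ.pos-* q _) (cong (+ q *ℤ_) (ℤ.pos-* (s + j) (c * s))) ⟩
  + q *ℤ (+ (s + j) *ℤ + (c * s))            ≡⟨ cong (λ z → + q *ℤ (+ (s + j) *ℤ + z)) c*s≡ ⟩
  + q *ℤ (+ (s + j) *ℤ + rotationCyclePoints (q * s) s (j * q)) ≡⟨ cong (+ q *ℤ_) (rotationCyclePoints-formula 1≤s 1≤q) ⟩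
  + q *ℤ (+ s *ℤ mobiusSum (q * s) s (j * q)) ≡⟨ sym (ℤ.*-assoc (+ q) (+ s) _) ⟩
  + q *ℤ + s *ℤ mobiusSum (q * s) s (j * q)  ≡⟨ cong (_*ℤ mobiusSum (q * s) s (j * q)) (sym (ℤ.pos-* q s)) ⟩
  + (q * s) *ℤ mobiusSum (q * s) s (j * q)   ∎
  where
  open ≡-Reasoning
  c = Cls (q * s) s (q * s) (j * q)
  1≤q : 1 ≤ q
  1≤q = *-positiveʳ s (subst (1 ≤_) (*-comm q s) 1≤ℓ)
  rearrange : ∀ s q j c → (s * (q * s) + s * (j * q)) * c ≡ q * ((s + j) * (c * s))
  rearrange = solve-∀
  c*s≡ : c * s ≡ rotationCyclePoints (q * s) s (j * q)
  c*s≡ = begin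
    c * s                                      ≡⟨ cong (_* s) (Cls≡cyclePoints-div s (j * q) 1≤ℓ ≤-refl) ⟩
    cyclePoints (q * s) s (q * s) (j * q) div s * s ≡⟨ *-comm _ s ⟩
    s * (cyclePoints (q * s) s (q * s) (j * q) div s) ≡⟨ div-cancelˡ 1≤s (∣cyclePoints (q * s) (q * s) (j * q) 1≤s) ⟩
    cyclePoints (q * s) s (q * s) (j * q)      ≡⟨ cyclePoints-n≡ℓ (q * s) s (j * q) ⟩
    rotationCyclePoints (q * s) s (j * q)      ∎

theorem4p1 : (ℓ s : ℕ) → 1 ≤ s → s ≤ ℓ → 1 < ℓ →
    (n k : ℕ) → ℓ ≤ n → 1 ≤ k →
      (k ≡ 1 → s ≡ ℓ → Cls ℓ s n k ≡ 1)
    × (k ≡ 1 → s ≡ 1 → Cls ℓ s n k ≡ n ∸ ℓ)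
    × (k ≡ 1 → s ≢ 1 → s ≢ ℓ → Cls ℓ s n k ≡ 0)
    × (1 < k → n ≡ ℓ → (s ∣ ℓ × (ℓ div s) ∣ k) →
         + (s * ℓ + s * k) *ℤ + Cls ℓ s n k ≡ + ℓ *ℤ mobiusSum ℓ s k)
    × (1 < k → n ≡ ℓ → ¬ (s ∣ ℓ × (ℓ div s) ∣ k) → Cls ℓ s n k ≡ 0)
    × (1 < k → ℓ < n → Cls ℓ s n k ≡ Cls ℓ s (n ∸ 1) k + Cls ℓ s n (k ∸ 1))
theorem4p1 ℓ s 1≤s s≤ℓ 1<ℓ n k ℓ≤n 1≤k =
    (λ { refl refl → Cls-ℓ-cycle-k≡1 1<ℓ ℓ≤n })
  , (λ { refl refl → Cls-fixedPoints-k≡1 1<ℓ ℓ≤n })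
  , (λ { refl s≢1 s≢ℓ → Cls-k≡1-vanishes 1≤ℓ ℓ≤n (≤∧≢⇒< 1≤s (s≢1 ∘ sym)) s≢ℓ })
  , (λ { _ refl (s∣ℓ , ℓ/s∣k) → Cls-n≡ℓ-formula 1≤s 1≤ℓ s∣ℓ ℓ/s∣k })
  , (λ { _ refl ∤ → Cls-n≡ℓ-vanishes 1≤ℓ ∤ })
  , (λ _ ℓ<n → Cls-recursion 1≤ℓ 1≤s 1≤k ℓ<n)
  where
  1≤ℓ : 1 ≤ ℓ
  1≤ℓ = ≤-trans 1≤s s≤ℓ
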